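{- Let $p\ge2$ and let $a=(a_n)_{n\ge1}$ be a $p$-automatic sequence whose alphabet is a subset of a commutative ring $R$. Define $$L(a,x_0,\dots,x_{p-1})=\sum_{n\ge1}a_n\,x_0^{\ell_0(n)}\cdots x_{p-1}^{\ell_{p-1}(n)}\in R[[x_0,\dots,x_{p-1}]],$$ where $\ell_i(n)$ is the number of occurrences of the digit $i$ in the base-$p$ expansion of $n$. Let $M$ be the weighted adjacency matrix of $\Gamma(a)$, i.e. the matrix indexed by $N(a)\times N(a)$ (for a fixed ordering of $N(a)$) with entries $M_{u,v}=\sum_{i\,:\,u^{t_i}=v}x_i\in\mathbb{Z}[x_0,\dots,x_{p-1}]$, and let $I$ be the identity matrix. Then $I-M$ is invertible over $\mathbb{Q}(x_0,\dots,x_{p-1})$, and $L(a,x_0,\dots,x_{p-1})$ is a rational fraction: there is a column vector $C$ indexed by $N(a)$ whose entries are linear forms in $x_1,\dots,x_{p-1}$ with coefficients in $R$ such that $L(a,x_0,\dots,x_{p-1})$ is the entry (indexed by $a$) of $(I-M)^{ -1}C$, the latter being understood as a power series expansion.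
   Context: Sequences are indexed from $n=1$. A $p$-automaton consists of a finite set of states, an initial state, a labeling map to a finite alphabet, and for each state and each $i\in\{0,\dots,p-1\}$ exactly one outgoing arrow labeled $i$; it produces $(a_n)_{n\ge1}$ where $a_n$ is the label of the state reached from the initial state by following the arrows labeled by the base-$p$ digits of $n$, read from right (least significant) to left. A sequence is $p$-automatic if some $p$-automaton produces it. For integers $i,j\ge0$ with $j<p^i$, $a^{(i,j)}=(a_{p^in+j})_{n\ge1}$ and $N(a)=\{a^{(i,j)}\}$ (finite for automatic $a$). For $u\in N(a)$ and $0\le i<p$, $u^{t_i}=(u_{pn+i})_{n\ge1}\in N(a)$. $\Gamma(a)$ is the labeled directed graph with vertex set $N(a)$ and an arrow labeled $i$ from $u$ to $u^{t_i}$. -}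

module Defs where

open import Level using (Level)
open import Data.Nat as ℕ using (ℕ; zero; suc; NonZero)
open import Data.Nat.DivMod using (_mod_; _div_)
open import Data.Fin as Fin using (Fin; toℕ)
open import Data.Vec as Vec using (Vec; []; _∷_; replicate; _[_]≔_; tabulate)
open import Data.Vec.Properties using (≡-dec)
open import Data.List as List using (List; []; _∷_; upTo; allFin; concatMap; map; filter; length)
open import Data.Product using (Σ; ∃; ∃-syntax; _×_; _,_; proj₁; proj₂)
open import Relation.Nullary using (¬_; yes; no; does)
open import Relation.Binary.PropositionalEquality using (_≡_)
open import Data.Bool using (if_then_else_)
open import Algebra.Bundles using (CommutativeRing)
open import Data.Integer using (ℤ)
open import Data.Integer.Properties using (+-*-commutativeRing)

module Digits (p : ℕ) .{{_ : NonZero p}} where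

  -- fuel-based; with fuel n this is the full base-p expansion of n when p ≥ 2
  digitsAux : ℕ → ℕ → List (Fin p)
  digitsAux zero    n       = []
  digitsAux (suc f) zero    = []
  digitsAux (suc f) (suc n) = (suc n mod p) ∷ digitsAux f (suc n div p)

  digits : ℕ → List (Fin p)
  digits n = digitsAux n n

  ℓ : Fin p → ℕ → ℕ
  ℓ i n = length (filter (Fin._≟ i) (digits n))

  expVec : ℕ → Vec ℕ p
  expVec n = tabulate (λ i → ℓ i n)

-- p-automata, automatic sequences, the kernel N(a) and the maps t_i,
-- for sequences (a_n)_{n ≥ 1} with values in a commutative ring R
-- (represented as ℕ → Carrier; the value at 0 is irrelevant).

module Auto {c ℓ' : Level} (R : CommutativeRing c ℓ') (p : ℕ) .{{_ : NonZero p}} where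
  open CommutativeRing R
  open Digits p

  Seq : Set c
  Seq = ℕ → Carrier

  _≋_ : Seq → Seq → Set ℓ'
  u ≋ v = ∀ n → 1 ℕ.≤ n → u n ≈ v n

  record Automaton : Set c where
    field
      nStates : ℕ
      initial : Fin nStates
      label   : Fin nStates → Carrier
      δ       : Fin nStates → Fin p → Fin nStates

    run : Fin nStates → List (Fin p) → Fin nStates
    run q []       = q
    run q (d ∷ ds) = run (δ q d) ds

    -- produced sequence: digits read from least significant to most
    output : Seq
    output n = label (run initial (digits n))

  IsAutomatic : Seq → Set (c Level.⊔ ℓ')
  IsAutomatic a = Σ Automaton λ A → Automaton.output A ≋ a

  sub : Seq → ℕ → ℕ → Seq
  sub a i j n = a (p ℕ.^ i ℕ.* n ℕ.+ j)

  InKernel : Seq → Seq → Set ℓ'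
  InKernel a u = ∃[ i ] ∃[ j ] (j ℕ.< p ℕ.^ i × u ≋ sub a i j)

  shift : Fin p → Seq → Seq
  shift i u n = u (p ℕ.* n ℕ.+ toℕ i)

  record EnumeratesKernel (a : Seq) (k : ℕ) (e : Fin k → Seq) : Set (c Level.⊔ ℓ') where
    field
      inKernel : ∀ u → InKernel a (e u)
      covers   : ∀ v → InKernel a v → ∃[ u ] (e u ≋ v)
      distinct : ∀ u w → e u ≋ e w → u ≡ w

-- Formal power series in p variables x_0,…,x_{p-1} over a commutative ring S.
-- A series is its coefficient function on exponent vectors Vec ℕ p.

module Series {c ℓ' : Level} (S : CommutativeRing c ℓ') (p : ℕ) where
  open CommutativeRing S

  PS : Set c
  PS = Vec ℕ p → Carrier

  _≐_ : PS → PS → Set ℓ'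
  f ≐ g = ∀ m → f m ≈ g m

  sumL : List Carrier → Carrier
  sumL = List.foldr _+_ 0#

  splits : ∀ {q} → Vec ℕ q → List (Vec ℕ q × Vec ℕ q)
  splits []       = ([] , []) ∷ []
  splits (m ∷ ms) = concatMap (λ j → map (λ ab → (j ∷ proj₁ ab , (m ℕ.∸ j) ∷ proj₂ ab)) (splits ms))
                              (upTo (suc m))

  zeroS : PS
  zeroS _ = 0#

  oneS : PS
  oneS m = if does (≡-dec ℕ._≟_ m (replicate p 0)) then 1# else 0#

  _⊕_ : PS → PS → PS
  (f ⊕ g) m = f m + g m

  ⊖_ : PS → PS
  (⊖ f) m = - (f m)

  _⊗_ : PS → PS → PS
  (f ⊗ g) m = sumL (map (λ ab → f (proj₁ ab) * g (proj₂ ab)) (splits m))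

  unitV : Fin p → Vec ℕ p
  unitV i = replicate p 0 [ i ]≔ 1

  var : Fin p → PS
  var i m = if does (≡-dec ℕ._≟_ m (unitV i)) then 1# else 0#

  sumS : List PS → PS
  sumS = List.foldr _⊕_ zeroS

  IsPoly : PS → Set ℓ'
  IsPoly f = ∃[ B ] ∀ m → B ℕ.< Vec.sum m → f m ≈ 0#

  NonZeroS : PS → Set ℓ'
  NonZeroS f = ∃[ m ] ¬ (f m ≈ 0#)

  -- linear form  Σ_{i=1}^{p-1} c_i x_i  (the coefficient c_0 is ignored)
  linForm : (Fin p → Carrier) → PS
  linForm cf = sumS (map (λ i → λ m → if does (toℕ i ℕ.≟ 0) then 0# else (cf i * var i m))
                         (allFin p))

  Mat : ℕ → Set c
  Mat k = Fin k → Fin k → PS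

  Col : ℕ → Set c
  Col k = Fin k → PS

  _≐M_ : ∀ {k} → Mat k → Mat k → Set ℓ'
  A ≐M B = ∀ u v → A u v ≐ B u v

  idM : ∀ {k} → Mat k
  idM u v = if does (u Fin.≟ v) then oneS else zeroS

  scalarM : ∀ {k} → PS → Mat k
  scalarM d u v = if does (u Fin.≟ v) then d else zeroS

  _·_ : ∀ {k} → Mat k → Mat k → Mat k
  _·_ {k} A B u v = sumS (map (λ w → A u w ⊗ B w v) (allFin k))

  _▹_ : ∀ {k} → Mat k → Col k → Col k
  _▹_ {k} A C u = sumS (map (λ w → A u w ⊗ C w) (allFin k))

  -- weighted adjacency matrix of Γ(a), given the transitions t : u ↦ u^{t_i}
  -- on the enumerated vertex set:  M_{u,v} = Σ_{i : u^{t_i} = v} x_i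
  adjM : ∀ {k} → (Fin k → Fin p → Fin k) → Mat k
  adjM t u v = sumS (map (λ i → if does (t u i Fin.≟ v) then var i else zeroS) (allFin p))

  IminusM : ∀ {k} → (Fin k → Fin p → Fin k) → Mat k
  IminusM t u v = idM u v ⊕ (⊖ adjM t u v)

module ZSeries = Series +-*-commutativeRing

-- Coefficient of x^m: sum of a_n over n ≥ 1 with (ℓ_i(n))_i = m; such n
-- have exactly |m| = Σ m_i digits, so n ≤ p^{|m|} and the sum is finite.

module Gen {c ℓ' : Level} (R : CommutativeRing c ℓ') (p : ℕ) .{{_ : NonZero p}} where
  open CommutativeRing R
  open Digits p
  open Series R p

  L : (ℕ → Carrier) → PS
  L a m = sumL (map (λ n → if does (≡-dec ℕ._≟_ (expVec n) m) then a n else 0#)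
                    (map suc (upTo (p ℕ.^ Vec.sum m))))

-- Invertibility of a matrix over ℤ[x] inside Q(x_0,…,x_{p-1}):
-- there are B over ℤ[x] and a nonzero d ∈ ℤ[x] with A·B = B·A = d·I
-- (equivalently A^{-1} = B/d exists with entries in Q(x)).

module _ (p : ℕ) where
  open ZSeries p

  InvertibleOverQx : ∀ {k} → Mat k → Set
  InvertibleOverQx {k} A =
    Σ (Mat k) λ B → Σ PS λ d →
      (∀ u v → IsPoly (B u v)) × IsPoly d × NonZeroS d ×
      ((A · B) ≐M scalarM d) × ((B · A) ≐M scalarM d)

-- Splitting off the least significant digit i of n = p q + i shows that the series Λ_u = L(u)
-- attached to the vertices of Γ(a) satisfy L(u) = ∑_{0<i<p} u_i x_i + ∑_i x_i L(u^{t_i}),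
-- i.e. the linear system (I - M) Λ = C. Since I - M has constant term I, division-free Gaussian
-- elimination gives a polynomial matrix B and a polynomial d with d(0) = 1 and
-- (I - M) B = B (I - M) = d I; so d ≠ 0 and I - M is invertible over Q(x). Over R[[x]] the series d
-- is a unit (its inverse is a geometric series), hence (I - M)⁻¹ = d⁻¹ B and Λ = (I - M)⁻¹ C.

module Submission where

open import Defs
open import Level using (Level)
open import Data.Nat using (ℕ; _≤_; NonZero)
open import Data.Fin using (Fin)
open import Data.Product using (Σ; _×_)
open import Algebra.Bundles using (CommutativeRing)
open import Algebra.Morphism.Structures using (module RingMorphisms)
open import Algebra.Structures using (IsCommutativeRing)
open import Data.Bool using (Bool; true; false; _∧_; if_then_else_; T)
open import Data.Fin as Fin using (toℕ; fromℕ<)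
import Data.Fin.Properties as Finₚ
open import Data.Integer.Properties using (+-*-commutativeRing)
open import Data.List as List using (List; []; _∷_; _++_; map; concatMap; foldr; upTo; applyUpTo; allFin; length; filter)
import Data.List.Properties as Listₚ
open import Data.Nat as ℕ using (zero; suc; _∸_; _<_; s≤s; z≤n; _^_)
open import Data.Nat.DivMod
  using (_%_; _/_; _mod_; _div_; %-congˡ; /-congˡ; [m+kn]%n≡m%n; m<n⇒m%n≡m; m*n%n≡0; +-distrib-/; m<n⇒m/n≡0; m*n/n≡m; m/n<m)
import Data.Nat.Properties as ℕₚ
open import Data.Product using (_,_; proj₁; proj₂)
open import Data.Sum using (_⊎_; inj₁; inj₂)
open import Data.Unit using (tt)
open import Data.Vec as Vec using (Vec; []; _∷_; replicate; lookup; tabulate; zipWith; _[_]≔_)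
import Data.Vec.Properties as Vecₚ
open import Function.Bundles using (mk⇔)
open import Relation.Nullary using (does; yes; no; ¬_; contradiction)
open import Relation.Nullary.Decidable using (dec-true; dec-false; does-⇔)
import Relation.Binary.PropositionalEquality as ≡
open ≡ using (_≡_; _≢_)

module Sums {c ℓ} (R : CommutativeRing c ℓ) where
  private
    variable
      a b : Level
      A : Set a
      B : Set b

  open CommutativeRing R
  open import Algebra.Properties.Ring ring using (-1*x≈-x)
  open import Algebra.Properties.CommutativeSemigroup +-commutativeSemigroup using (interchange)
  open import Relation.Binary.Reasoning.Setoid setoid

  ∑ : List A → (A → Carrier) → Carrier
  ∑ xs f = foldr _+_ 0# (map f xs)

  syntax ∑ xs (λ x → e) = ∑[ x ∈ xs ] e

  ∑< : ℕ → (ℕ → Carrier) → Carrier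
  ∑< zero    f = 0#
  ∑< (suc n) f = f 0 + ∑< n (λ j → f (suc j))

  syntax ∑< n (λ j → e) = ∑[ j < n ] e

  ∑-cong : (xs : List A) {f g : A → Carrier} → (∀ x → f x ≈ g x) → ∑ xs f ≈ ∑ xs g
  ∑-cong []       f≈g = refl
  ∑-cong (x ∷ xs) f≈g = +-cong (f≈g x) (∑-cong xs f≈g)

  ∑-+ : (xs : List A) (f g : A → Carrier) → ∑[ x ∈ xs ] (f x + g x) ≈ ∑ xs f + ∑ xs g
  ∑-+ []       f g = sym (+-identityˡ 0#)
  ∑-+ (x ∷ xs) f g = trans (+-congˡ (∑-+ xs f g)) (interchange (f x) (g x) _ _)

  ∑-zero : (xs : List A) → ∑[ x ∈ xs ] 0# ≈ 0#
  ∑-zero []       = refl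
  ∑-zero (x ∷ xs) = trans (+-identityˡ _) (∑-zero xs)

  ∑-*ˡ : (xs : List A) (k : Carrier) (f : A → Carrier) → k * ∑ xs f ≈ ∑[ x ∈ xs ] (k * f x)
  ∑-*ˡ []       k f = zeroʳ k
  ∑-*ˡ (x ∷ xs) k f = trans (distribˡ k _ _) (+-congˡ (∑-*ˡ xs k f))

  ∑-*ʳ : (xs : List A) (k : Carrier) (f : A → Carrier) → ∑ xs f * k ≈ ∑[ x ∈ xs ] (f x * k)
  ∑-*ʳ []       k f = zeroˡ k
  ∑-*ʳ (x ∷ xs) k f = trans (distribʳ k _ _) (+-congˡ (∑-*ʳ xs k f))

  ∑-neg : (xs : List A) (f : A → Carrier) → - ∑ xs f ≈ ∑[ x ∈ xs ] (- f x)
  ∑-neg xs f = begin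
    - ∑ xs f                 ≈⟨ -1*x≈-x _ ⟨
    - 1# * ∑ xs f            ≈⟨ ∑-*ˡ xs (- 1#) f ⟩
    ∑[ x ∈ xs ] (- 1# * f x) ≈⟨ ∑-cong xs (λ x → -1*x≈-x (f x)) ⟩
    ∑[ x ∈ xs ] (- f x)      ∎

  ∑-swap : (xs : List A) (ys : List B) (f : A → B → Carrier) →
           ∑[ x ∈ xs ] ∑[ y ∈ ys ] f x y ≈ ∑[ y ∈ ys ] ∑[ x ∈ xs ] f x y
  ∑-swap []       ys f = sym (∑-zero ys)
  ∑-swap (x ∷ xs) ys f = trans (+-congˡ (∑-swap xs ys f)) (sym (∑-+ ys (f x) _))

  ∑-map : (g : A → B) (xs : List A) (f : B → Carrier) → ∑ (map g xs) f ≡ ∑[ x ∈ xs ] f (g x)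
  ∑-map g xs f = ≡.cong (foldr _+_ 0#) (≡.sym (Listₚ.map-∘ xs))

  ∑-++ : (xs ys : List A) (f : A → Carrier) → ∑ (xs ++ ys) f ≈ ∑ xs f + ∑ ys f
  ∑-++ []       ys f = sym (+-identityˡ _)
  ∑-++ (x ∷ xs) ys f = trans (+-congˡ (∑-++ xs ys f)) (sym (+-assoc _ _ _))

  ∑-concatMap : (g : A → List B) (xs : List A) (f : B → Carrier) →
                ∑ (concatMap g xs) f ≈ ∑[ x ∈ xs ] ∑ (g x) f
  ∑-concatMap g []       f = refl
  ∑-concatMap g (x ∷ xs) f = trans (∑-++ (g x) (concatMap g xs) f) (+-congˡ (∑-concatMap g xs f))

  ∑-upTo : ∀ n (f : ℕ → Carrier) → ∑ (upTo n) f ≡ ∑< n f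
  ∑-upTo n f = go n (λ j → j)
    where
    go : ∀ n (g : ℕ → ℕ) → ∑ (applyUpTo g n) f ≡ ∑[ j < n ] f (g j)
    go zero    g = ≡.refl
    go (suc n) g = ≡.cong (f (g 0) +_) (go n (λ j → g (suc j)))

  ∑<-cong : ∀ n {f g : ℕ → Carrier} → (∀ j → j < n → f j ≈ g j) → ∑< n f ≈ ∑< n g
  ∑<-cong zero    f≈g = refl
  ∑<-cong (suc n) f≈g = +-cong (f≈g 0 (s≤s z≤n)) (∑<-cong n (λ j j<n → f≈g (suc j) (s≤s j<n)))

  ∑<-cong′ : ∀ n {f g : ℕ → Carrier} → (∀ j → f j ≈ g j) → ∑< n f ≈ ∑< n g
  ∑<-cong′ n f≈g = ∑<-cong n (λ j _ → f≈g j)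

  ∑<-zero : ∀ n → ∑[ j < n ] 0# ≈ 0#
  ∑<-zero zero    = refl
  ∑<-zero (suc n) = trans (+-identityˡ _) (∑<-zero n)

  ∑<-+ : ∀ n (f g : ℕ → Carrier) → ∑[ j < n ] (f j + g j) ≈ ∑< n f + ∑< n g
  ∑<-+ zero    f g = sym (+-identityˡ 0#)
  ∑<-+ (suc n) f g = trans (+-congˡ (∑<-+ n _ _)) (interchange (f 0) (g 0) _ _)

  ∑<-+-split : ∀ m n (f : ℕ → Carrier) → ∑< (m ℕ.+ n) f ≈ ∑< m f + ∑[ j < n ] f (m ℕ.+ j)
  ∑<-+-split zero    n f = sym (+-identityˡ _)
  ∑<-+-split (suc m) n f = trans (+-congˡ (∑<-+-split m n _)) (sym (+-assoc _ _ _))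

  ∑<-snoc : ∀ n (f : ℕ → Carrier) → ∑< (suc n) f ≈ ∑< n f + f n
  ∑<-snoc zero    f = trans (+-identityʳ _) (sym (+-identityˡ _))
  ∑<-snoc (suc n) f = trans (+-congˡ (∑<-snoc n _)) (sym (+-assoc _ _ _))

  ∑<-reverse : ∀ n (f : ℕ → Carrier) → ∑< n f ≈ ∑[ j < n ] f (n ∸ suc j)
  ∑<-reverse zero    f = refl
  ∑<-reverse (suc n) f = begin
    f 0 + ∑[ j < n ] f (suc j)                  ≈⟨ +-congˡ (∑<-reverse n _) ⟩
    f 0 + ∑[ j < n ] f (suc (n ∸ suc j))        ≈⟨ +-comm _ _ ⟩
    ∑[ j < n ] f (suc (n ∸ suc j)) + f 0        ≈⟨ +-cong (∑<-cong n (λ j j<n → reflexive (≡.cong f (≡.sym (ℕₚ.+-∸-assoc 1 j<n)))))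
                                                          (reflexive (≡.cong f (≡.sym (ℕₚ.n∸n≡0 n)))) ⟩
    ∑[ j < n ] f (suc n ∸ suc j) + f (n ∸ n)    ≈⟨ ∑<-snoc n _ ⟨
    ∑[ j < suc n ] f (suc n ∸ suc j)            ∎

  ∑-∑< : (xs : List A) (n : ℕ) (f : A → ℕ → Carrier) →
         ∑[ x ∈ xs ] ∑< n (f x) ≈ ∑[ j < n ] ∑[ x ∈ xs ] f x j
  ∑-∑< xs n f = begin
    ∑[ x ∈ xs ] ∑< n (f x)                ≈⟨ ∑-cong xs (λ x → reflexive (≡.sym (∑-upTo n (f x)))) ⟩
    ∑[ x ∈ xs ] ∑ (upTo n) (f x)          ≈⟨ ∑-swap xs (upTo n) f ⟩
    ∑[ j ∈ upTo n ] ∑[ x ∈ xs ] f x j     ≡⟨ ∑-upTo n _ ⟩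
    ∑[ j < n ] ∑[ x ∈ xs ] f x j          ∎

  ∑<-triangle : ∀ n (f : ℕ → ℕ → Carrier) →
    ∑[ j < n ] ∑[ i < suc j ] f i j ≈ ∑[ i < n ] ∑[ l < n ∸ i ] f i (i ℕ.+ l)
  ∑<-triangle zero    f = refl
  ∑<-triangle (suc n) f = begin
    ∑< (suc n) col                                ≈⟨ ∑<-snoc n col ⟩
    ∑< n col + col n                              ≈⟨ +-congʳ (∑<-triangle n f) ⟩
    ∑< n row + col n                              ≈⟨ +-congʳ (+-identityʳ _) ⟨
    ∑< n row + 0# + col n                         ≈⟨ +-congʳ (+-congˡ emptyRow) ⟨
    ∑< n row + row n + col n                      ≈⟨ +-congʳ (∑<-snoc n row) ⟨
    ∑< (suc n) row + ∑[ i < suc n ] f i n         ≈⟨ ∑<-+ (suc n) row (λ i → f i n) ⟨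
    ∑[ i < suc n ] (row i + f i n)                ≈⟨ ∑<-cong (suc n) extendRow ⟩
    ∑[ i < suc n ] ∑[ l < suc n ∸ i ] f i (i ℕ.+ l) ∎
    where
    col row : ℕ → Carrier
    col j = ∑[ i < suc j ] f i j
    row i = ∑[ l < n ∸ i ] f i (i ℕ.+ l)
    emptyRow : row n ≈ 0#
    emptyRow = reflexive (≡.cong (λ z → ∑[ l < z ] f n (n ℕ.+ l)) (ℕₚ.n∸n≡0 n))
    extendRow : ∀ i → i < suc n → row i + f i n ≈ ∑[ l < suc n ∸ i ] f i (i ℕ.+ l)
    extendRow i (s≤s i≤n) = begin
      row i + f i n                         ≈⟨ +-congˡ (reflexive (≡.cong (f i) (≡.sym (ℕₚ.m+[n∸m]≡n i≤n)))) ⟩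
      row i + f i (i ℕ.+ (n ∸ i))           ≈⟨ ∑<-snoc (n ∸ i) _ ⟨
      ∑[ l < suc (n ∸ i) ] f i (i ℕ.+ l)    ≡⟨ ≡.cong (λ z → ∑[ l < z ] f i (i ℕ.+ l)) (≡.sym (ℕₚ.+-∸-assoc 1 i≤n)) ⟩
      ∑[ l < suc n ∸ i ] f i (i ℕ.+ l)      ∎

  ∑<-blocks : ∀ p Q (f : ℕ → Carrier) → ∑< (p ℕ.* Q) f ≈ ∑[ q < Q ] ∑[ r < p ] f (p ℕ.* q ℕ.+ r)
  ∑<-blocks p zero    f = reflexive (≡.cong (λ n → ∑< n f) (ℕₚ.*-zeroʳ p))
  ∑<-blocks p (suc Q) f = begin
    ∑< (p ℕ.* suc Q) f                                                   ≡⟨ ≡.cong (λ n → ∑< n f) (ℕₚ.*-suc p Q) ⟩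
    ∑< (p ℕ.+ p ℕ.* Q) f                                                 ≈⟨ ∑<-+-split p (p ℕ.* Q) f ⟩
    ∑< p f + ∑[ j < p ℕ.* Q ] f (p ℕ.+ j)                                ≈⟨ +-cong (∑<-cong′ p (λ r → reflexive (≡.cong (λ n → f (n ℕ.+ r)) (≡.sym (ℕₚ.*-zeroʳ p)))))
                                                                                    (∑<-blocks p Q (λ j → f (p ℕ.+ j))) ⟩
    ∑[ r < p ] f (p ℕ.* 0 ℕ.+ r) + ∑[ q < Q ] ∑[ r < p ] f (p ℕ.+ (p ℕ.* q ℕ.+ r))
                                                                          ≈⟨ +-congˡ (∑<-cong′ Q (λ q → ∑<-cong′ p (λ r → reflexive (≡.cong f (nextBlock q r))))) ⟩
    ∑[ q < suc Q ] ∑[ r < p ] f (p ℕ.* q ℕ.+ r)                          ∎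
    where
    nextBlock : ∀ q r → p ℕ.+ (p ℕ.* q ℕ.+ r) ≡ p ℕ.* suc q ℕ.+ r
    nextBlock q r = ≡.trans (≡.sym (ℕₚ.+-assoc p (p ℕ.* q) r)) (≡.cong (ℕ._+ r) (≡.sym (ℕₚ.*-suc p q)))

  ∑-allFin-suc : ∀ {n} (f : Fin (suc n) → Carrier) → ∑ (allFin (suc n)) f ≡ f Fin.zero + ∑[ i ∈ allFin n ] f (Fin.suc i)
  ∑-allFin-suc f = ≡.cong (λ xs → f Fin.zero + foldr _+_ 0# xs)
    (≡.trans (Listₚ.map-tabulate Fin.suc f) (≡.sym (Listₚ.map-tabulate (λ i → i) (λ i → f (Fin.suc i)))))

  ∑<-allFin : ∀ n (f : ℕ → Carrier) → ∑< n f ≡ ∑[ i ∈ allFin n ] f (toℕ i)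
  ∑<-allFin zero    f = ≡.refl
  ∑<-allFin (suc n) f = ≡.trans (≡.cong (f 0 +_) (∑<-allFin n (λ j → f (suc j)))) (≡.sym (∑-allFin-suc {n} (λ i → f (toℕ i))))

module ExponentVectors where
  open import Algebra.Properties.CommutativeSemigroup ℕₚ.+-commutativeSemigroup using () renaming (interchange to ℕ-interchange)

  private
    variable
      q : ℕ

  infixl 6 _+ᵛ_ _∸ᵛ_
  infix 4 _≤ᵛᵇ_

  _+ᵛ_ _∸ᵛ_ : Vec ℕ q → Vec ℕ q → Vec ℕ q
  _+ᵛ_ = zipWith ℕ._+_
  _∸ᵛ_ = zipWith ℕ._∸_

  _≤ᵛᵇ_ : Vec ℕ q → Vec ℕ q → Bool
  []       ≤ᵛᵇ []       = true
  (c ∷ cs) ≤ᵛᵇ (x ∷ xs) = (c ℕ.≤ᵇ x) ∧ (cs ≤ᵛᵇ xs)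

  0ᵛ : Vec ℕ q
  0ᵛ = replicate _ 0

  unitᵛ : Fin q → Vec ℕ q
  unitᵛ i = 0ᵛ [ i ]≔ 1

  ≡-byLookup : {v w : Vec ℕ q} → (∀ j → lookup v j ≡ lookup w j) → v ≡ w
  ≡-byLookup {v = v} {w} v≗w =
    ≡.trans (≡.sym (Vecₚ.tabulate∘lookup v)) (≡.trans (Vecₚ.tabulate-cong v≗w) (Vecₚ.tabulate∘lookup w))

  sum-+ᵛ : (a b : Vec ℕ q) → Vec.sum (a +ᵛ b) ≡ Vec.sum a ℕ.+ Vec.sum b
  sum-+ᵛ []      []      = ≡.refl
  sum-+ᵛ (x ∷ a) (y ∷ b) = ≡.trans (≡.cong ((x ℕ.+ y) ℕ.+_) (sum-+ᵛ a b)) (ℕ-interchange x y _ _)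

  sum-0ᵛ : ∀ q → Vec.sum (0ᵛ {q}) ≡ 0
  sum-0ᵛ zero    = ≡.refl
  sum-0ᵛ (suc q) = sum-0ᵛ q

  sum-unitᵛ : (i : Fin q) → Vec.sum (unitᵛ i) ≡ 1
  sum-unitᵛ {suc q} Fin.zero    = ≡.cong suc (sum-0ᵛ q)
  sum-unitᵛ {suc q} (Fin.suc i) = sum-unitᵛ i

  lookup-unitᵛ : (i j : Fin q) → lookup (unitᵛ i) j ≡ (if does (i Fin.≟ j) then 1 else 0)
  lookup-unitᵛ Fin.zero    Fin.zero    = ≡.refl
  lookup-unitᵛ Fin.zero    (Fin.suc j) = Vecₚ.lookup-replicate j 0
  lookup-unitᵛ (Fin.suc i) Fin.zero    = ≡.refl
  lookup-unitᵛ (Fin.suc i) (Fin.suc j) = lookup-unitᵛ i j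

  sum≡0⇒≡0ᵛ : (m : Vec ℕ q) → Vec.sum m ≡ 0 → m ≡ 0ᵛ
  sum≡0⇒≡0ᵛ []         _   = ≡.refl
  sum≡0⇒≡0ᵛ (zero ∷ m) Σ≡0 = ≡.cong (0 ∷_) (sum≡0⇒≡0ᵛ m Σ≡0)

  +ᵛ-identityʳ : (c : Vec ℕ q) → c +ᵛ 0ᵛ ≡ c
  +ᵛ-identityʳ []      = ≡.refl
  +ᵛ-identityʳ (x ∷ c) = ≡.cong₂ _∷_ (ℕₚ.+-identityʳ x) (+ᵛ-identityʳ c)

  0ᵛ≤ᵛᵇ : (m : Vec ℕ q) → (0ᵛ ≤ᵛᵇ m) ≡ true
  0ᵛ≤ᵛᵇ []      = ≡.refl
  0ᵛ≤ᵛᵇ (x ∷ m) = 0ᵛ≤ᵛᵇ m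

  ∸ᵛ-identityʳ : (m : Vec ℕ q) → m ∸ᵛ 0ᵛ ≡ m
  ∸ᵛ-identityʳ []      = ≡.refl
  ∸ᵛ-identityʳ (x ∷ m) = ≡.cong (x ∷_) (∸ᵛ-identityʳ m)

  +ᵛ≡⇒≤ᵛᵇ : (c x m : Vec ℕ q) → c +ᵛ x ≡ m → (c ≤ᵛᵇ m) ≡ true
  +ᵛ≡⇒≤ᵛᵇ []       []       []                          _      = ≡.refl
  +ᵛ≡⇒≤ᵛᵇ (c ∷ cs) (x ∷ xs) (.(c ℕ.+ x) ∷ .(cs +ᵛ xs)) ≡.refl =
    ≡.cong₂ _∧_ (T⇒≡true (ℕₚ.≤⇒≤ᵇ (ℕₚ.m≤m+n c x))) (+ᵛ≡⇒≤ᵛᵇ cs xs _ ≡.refl)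
    where
    T⇒≡true : ∀ {b} → T b → b ≡ true
    T⇒≡true {true} _ = ≡.refl

  +ᵛ≡⇒≡∸ᵛ : (c x m : Vec ℕ q) → c +ᵛ x ≡ m → x ≡ m ∸ᵛ c
  +ᵛ≡⇒≡∸ᵛ []       []       []                          _      = ≡.refl
  +ᵛ≡⇒≡∸ᵛ (c ∷ cs) (x ∷ xs) (.(c ℕ.+ x) ∷ .(cs +ᵛ xs)) ≡.refl =
    ≡.cong₂ _∷_ (≡.sym (ℕₚ.m+n∸m≡n c x)) (+ᵛ≡⇒≡∸ᵛ cs xs _ ≡.refl)

  +ᵛ-∸ᵛ : (c m : Vec ℕ q) → (c ≤ᵛᵇ m) ≡ true → c +ᵛ (m ∸ᵛ c) ≡ m
  +ᵛ-∸ᵛ []       []       _ = ≡.refl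
  +ᵛ-∸ᵛ (c ∷ cs) (x ∷ xs) c∷cs≤x∷xs with c ℕ.≤ᵇ x in c≤x
  ... | true = ≡.cong₂ _∷_ (ℕₚ.m+[n∸m]≡n (ℕₚ.≤ᵇ⇒≤ c x (≡.subst T (≡.sym c≤x) tt))) (+ᵛ-∸ᵛ cs xs c∷cs≤x∷xs)

  does-+ᵛ≟ : (c x m : Vec ℕ q) →
    does (Vecₚ.≡-dec ℕ._≟_ (c +ᵛ x) m) ≡ ((c ≤ᵛᵇ m) ∧ does (Vecₚ.≡-dec ℕ._≟_ x (m ∸ᵛ c)))
  does-+ᵛ≟ c x m with c ≤ᵛᵇ m in c≤m
  ... | true  = does-⇔ (mk⇔ (+ᵛ≡⇒≡∸ᵛ c x m) (λ x≡m∸c → ≡.trans (≡.cong (c +ᵛ_) x≡m∸c) (+ᵛ-∸ᵛ c m c≤m)))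
                         (Vecₚ.≡-dec ℕ._≟_ (c +ᵛ x) m) (Vecₚ.≡-dec ℕ._≟_ x (m ∸ᵛ c))
  ... | false = dec-false (Vecₚ.≡-dec ℕ._≟_ (c +ᵛ x) m) (λ c+x≡m → true≢false (≡.trans (≡.sym (+ᵛ≡⇒≤ᵛᵇ c x m c+x≡m)) c≤m))
    where
    true≢false : true ≢ false
    true≢false ()

module Convolution {c ℓ} (S : CommutativeRing c ℓ) (p : ℕ) where
  open CommutativeRing S
  open Sums S
  open Series S p using (splits)
  open ExponentVectors
  open import Relation.Binary.Reasoning.Setoid setoid

  private
    variable
      q : ℕ

  ∑split : Vec ℕ q → (Vec ℕ q → Vec ℕ q → Carrier) → Carrier
  ∑split m F = ∑[ ab ∈ splits m ] F (proj₁ ab) (proj₂ ab)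

  ∑split-cons : ∀ x (ms : Vec ℕ q) (F : Vec ℕ (suc q) → Vec ℕ (suc q) → Carrier) →
    ∑split (x ∷ ms) F ≈ ∑[ j < suc x ] ∑split ms (λ a b → F (j ∷ a) ((x ∸ j) ∷ b))
  ∑split-cons x ms F = begin
    ∑split (x ∷ ms) F                                       ≈⟨ ∑-concatMap shift (upTo (suc x)) _ ⟩
    ∑[ j ∈ upTo (suc x) ] ∑ (shift j) (λ ab → F (proj₁ ab) (proj₂ ab))
      ≡⟨ ≡.cong (foldr′) (Listₚ.map-cong (λ j → ∑-map _ (splits ms) _) (upTo (suc x))) ⟩
    ∑[ j ∈ upTo (suc x) ] ∑split ms (λ a b → F (j ∷ a) ((x ∸ j) ∷ b)) ≡⟨ ∑-upTo (suc x) _ ⟩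
    ∑[ j < suc x ] ∑split ms (λ a b → F (j ∷ a) ((x ∸ j) ∷ b)) ∎
    where
    foldr′ = List.foldr _+_ 0#
    shift : ℕ → List (Vec ℕ (suc _) × Vec ℕ (suc _))
    shift j = map (λ ab → (j ∷ proj₁ ab , (x ∸ j) ∷ proj₂ ab)) (splits ms)

  ∑split-cong : (m : Vec ℕ q) {F G : Vec ℕ q → Vec ℕ q → Carrier} →
                (∀ a b → a +ᵛ b ≡ m → F a b ≈ G a b) → ∑split m F ≈ ∑split m G
  ∑split-cong []       F≈G = +-cong (F≈G [] [] ≡.refl) refl
  ∑split-cong (x ∷ ms) {F} {G} F≈G = begin
    ∑split (x ∷ ms) F                                       ≈⟨ ∑split-cons x ms F ⟩
    ∑[ j < suc x ] ∑split ms (λ a b → F (j ∷ a) ((x ∸ j) ∷ b))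
      ≈⟨ ∑<-cong (suc x) (λ j j≤x → ∑split-cong ms (λ a b a+b≡ms →
           F≈G (j ∷ a) ((x ∸ j) ∷ b) (≡.cong₂ _∷_ (ℕₚ.m+[n∸m]≡n (ℕₚ.≤-pred j≤x)) a+b≡ms))) ⟩
    ∑[ j < suc x ] ∑split ms (λ a b → G (j ∷ a) ((x ∸ j) ∷ b)) ≈⟨ ∑split-cons x ms G ⟨
    ∑split (x ∷ ms) G                                       ∎

  ∑split-cong′ : (m : Vec ℕ q) {F G : Vec ℕ q → Vec ℕ q → Carrier} →
                 (∀ a b → F a b ≈ G a b) → ∑split m F ≈ ∑split m G
  ∑split-cong′ m F≈G = ∑split-cong m (λ a b _ → F≈G a b)

  ∑split-zero : (m : Vec ℕ q) → ∑split m (λ _ _ → 0#) ≈ 0#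
  ∑split-zero m = ∑-zero (splits m)

  ∑split-∑< : (m : Vec ℕ q) (n : ℕ) (F : Vec ℕ q → Vec ℕ q → ℕ → Carrier) →
              ∑split m (λ a b → ∑< n (F a b)) ≈ ∑[ j < n ] ∑split m (λ a b → F a b j)
  ∑split-∑< m n F = ∑-∑< (splits m) n (λ ab → F (proj₁ ab) (proj₂ ab))

  ∑split-0ᵛ : (F : Vec ℕ q → Vec ℕ q → Carrier) → ∑split 0ᵛ F ≈ F 0ᵛ 0ᵛ
  ∑split-0ᵛ {zero}  F = +-identityʳ _
  ∑split-0ᵛ {suc q} F = trans (∑split-cons 0 0ᵛ F) (trans (+-identityʳ _) (∑split-0ᵛ (λ a b → F (0 ∷ a) (0 ∷ b))))

  ∑split-comm : (m : Vec ℕ q) (F : Vec ℕ q → Vec ℕ q → Carrier) → ∑split m F ≈ ∑split m (λ a b → F b a)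
  ∑split-comm []       F = refl
  ∑split-comm (x ∷ ms) F = begin
    ∑split (x ∷ ms) F                                                   ≈⟨ ∑split-cons x ms F ⟩
    ∑[ j < suc x ] ∑split ms (λ a b → F (j ∷ a) ((x ∸ j) ∷ b))         ≈⟨ ∑<-cong′ (suc x) (λ j → ∑split-comm ms (λ a b → F (j ∷ a) ((x ∸ j) ∷ b))) ⟩
    ∑[ j < suc x ] ∑split ms (λ a b → F (j ∷ b) ((x ∸ j) ∷ a))         ≈⟨ ∑<-reverse (suc x) (λ j → ∑split ms (λ a b → F (j ∷ b) ((x ∸ j) ∷ a))) ⟩
    ∑[ j < suc x ] ∑split ms (λ a b → F ((x ∸ j) ∷ b) ((x ∸ (x ∸ j)) ∷ a))
      ≈⟨ ∑<-cong (suc x) (λ j j≤x → reflexive (≡.cong (λ z → ∑split ms (λ a b → F ((x ∸ j) ∷ b) (z ∷ a)))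
                                                      (ℕₚ.m∸[m∸n]≡n (ℕₚ.≤-pred j≤x)))) ⟩
    ∑[ j < suc x ] ∑split ms (λ a b → F ((x ∸ j) ∷ b) (j ∷ a))         ≈⟨ ∑split-cons x ms (λ a b → F b a) ⟨
    ∑split (x ∷ ms) (λ a b → F b a)                                     ∎

  ∑split-assoc : (m : Vec ℕ q) (F : Vec ℕ q → Vec ℕ q → Vec ℕ q → Carrier) →
    ∑split m (λ ab c → ∑split ab (λ a b → F a b c)) ≈ ∑split m (λ a bc → ∑split bc (λ b c → F a b c))
  ∑split-assoc []       F = refl
  ∑split-assoc (x ∷ ms) F = begin
    ∑split (x ∷ ms) (λ ab c → ∑split ab (λ a b → F a b c))
      ≈⟨ ∑split-cons x ms (λ ab c → ∑split ab (λ a b → F a b c)) ⟩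
    ∑[ j < suc x ] ∑split ms (λ ab c → ∑split (j ∷ ab) (λ a b → F a b ((x ∸ j) ∷ c)))
      ≈⟨ ∑<-cong′ (suc x) (λ j → ∑split-cong′ ms (λ ab c → ∑split-cons j ab (λ a b → F a b ((x ∸ j) ∷ c)))) ⟩
    ∑[ j < suc x ] ∑split ms (λ ab c → ∑[ i < suc j ] ∑split ab (λ a b → F (i ∷ a) ((j ∸ i) ∷ b) ((x ∸ j) ∷ c)))
      ≈⟨ ∑<-cong′ (suc x) (λ j → ∑split-∑< ms (suc j) (λ ab c i → ∑split ab (λ a b → F (i ∷ a) ((j ∸ i) ∷ b) ((x ∸ j) ∷ c)))) ⟩
    ∑[ j < suc x ] ∑[ i < suc j ] ∑split ms (λ ab c → ∑split ab (λ a b → F (i ∷ a) ((j ∸ i) ∷ b) ((x ∸ j) ∷ c)))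
      ≈⟨ ∑<-cong′ (suc x) (λ j → ∑<-cong′ (suc j) (λ i → ∑split-assoc ms (λ a b c → F (i ∷ a) ((j ∸ i) ∷ b) ((x ∸ j) ∷ c)))) ⟩
    ∑[ j < suc x ] ∑[ i < suc j ] H i (j ∸ i) (x ∸ j)
      ≈⟨ ∑<-triangle (suc x) (λ i j → H i (j ∸ i) (x ∸ j)) ⟩
    ∑[ i < suc x ] ∑[ l < suc x ∸ i ] H i ((i ℕ.+ l) ∸ i) (x ∸ (i ℕ.+ l))
      ≈⟨ ∑<-cong (suc x) reindex ⟩
    ∑[ i < suc x ] ∑[ l < suc (x ∸ i) ] H i l (x ∸ i ∸ l)
      ≈⟨ ∑<-cong′ (suc x) (λ i → ∑split-∑< ms (suc (x ∸ i)) (λ a bc l → ∑split bc (λ b c → F (i ∷ a) (l ∷ b) ((x ∸ i ∸ l) ∷ c)))) ⟨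
    ∑[ i < suc x ] ∑split ms (λ a bc → ∑[ l < suc (x ∸ i) ] ∑split bc (λ b c → F (i ∷ a) (l ∷ b) ((x ∸ i ∸ l) ∷ c)))
      ≈⟨ ∑<-cong′ (suc x) (λ i → ∑split-cong′ ms (λ a bc → ∑split-cons (x ∸ i) bc (λ b c → F (i ∷ a) b c))) ⟨
    ∑[ i < suc x ] ∑split ms (λ a bc → ∑split ((x ∸ i) ∷ bc) (λ b c → F (i ∷ a) b c))
      ≈⟨ ∑split-cons x ms (λ a bc → ∑split bc (λ b c → F a b c)) ⟨
    ∑split (x ∷ ms) (λ a bc → ∑split bc (λ b c → F a b c))
      ∎
    where
    H : ℕ → ℕ → ℕ → Carrier
    H i l r = ∑split ms (λ a bc → ∑split bc (λ b c → F (i ∷ a) (l ∷ b) (r ∷ c)))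
    reindex : ∀ i → i < suc x →
      ∑[ l < suc x ∸ i ] H i ((i ℕ.+ l) ∸ i) (x ∸ (i ℕ.+ l)) ≈ ∑[ l < suc (x ∸ i) ] H i l (x ∸ i ∸ l)
    reindex i (s≤s i≤x) = begin
      ∑[ l < suc x ∸ i ] H i ((i ℕ.+ l) ∸ i) (x ∸ (i ℕ.+ l))
        ≡⟨ ≡.cong (λ z → ∑[ l < z ] H i ((i ℕ.+ l) ∸ i) (x ∸ (i ℕ.+ l))) (ℕₚ.+-∸-assoc 1 i≤x) ⟩
      ∑[ l < suc (x ∸ i) ] H i ((i ℕ.+ l) ∸ i) (x ∸ (i ℕ.+ l))
        ≈⟨ ∑<-cong′ (suc (x ∸ i)) (λ l → reflexive (≡.cong₂ (H i) (ℕₚ.m+n∸m≡n i l) (≡.sym (ℕₚ.∸-+-assoc x i l)))) ⟩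
      ∑[ l < suc (x ∸ i) ] H i l (x ∸ i ∸ l) ∎

  δ : Vec ℕ q → Vec ℕ q → Carrier
  δ a c = if does (Vecₚ.≡-dec ℕ._≟_ a c) then 1# else 0#

  ∑<-δ : ∀ n c (f : ℕ → Carrier) → ∑[ j < n ] (if does (j ℕ.≟ c) then f j else 0#) ≈ (if c ℕ.<ᵇ n then f c else 0#)
  ∑<-δ zero    c       f = refl
  ∑<-δ (suc n) zero    f = trans (+-congˡ (∑<-zero n)) (+-identityʳ _)
  ∑<-δ (suc n) (suc c) f = trans (+-identityˡ _) (∑<-δ n c (λ j → f (suc j)))

  ∑split-δ : (m c : Vec ℕ q) (G : Vec ℕ q → Vec ℕ q → Carrier) →
             ∑split m (λ a b → δ a c * G a b) ≈ (if c ≤ᵛᵇ m then G c (m ∸ᵛ c) else 0#)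
  ∑split-δ []       []       G = trans (+-identityʳ _) (*-identityˡ _)
  ∑split-δ (x ∷ ms) (c ∷ cs) G = begin
    ∑split (x ∷ ms) (λ a b → δ a (c ∷ cs) * G a b)               ≈⟨ ∑split-cons x ms _ ⟩
    ∑[ j < suc x ] ∑split ms (λ a b → δ (j ∷ a) (c ∷ cs) * G (j ∷ a) ((x ∸ j) ∷ b))
                                                                  ≈⟨ ∑<-cong′ (suc x) headDigit ⟩
    ∑[ j < suc x ] (if does (j ℕ.≟ c) then K j else 0#)          ≈⟨ ∑<-δ (suc x) c K ⟩
    (if c ℕ.<ᵇ suc x then K c else 0#)                           ≡⟨ ≡.cong (λ b → if b then K c else 0#) (<ᵇ-suc c x) ⟩
    (if c ℕ.≤ᵇ x then K c else 0#)                               ≈⟨ tailDigits (c ℕ.≤ᵇ x) ⟩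
    (if (c ℕ.≤ᵇ x) ∧ (cs ≤ᵛᵇ ms) then G (c ∷ cs) ((x ∸ c) ∷ (ms ∸ᵛ cs)) else 0#) ∎
    where
    K : ℕ → Carrier
    K j = ∑split ms (λ a b → δ a cs * G (j ∷ a) ((x ∸ j) ∷ b))
    headDigit : ∀ j → ∑split ms (λ a b → δ (j ∷ a) (c ∷ cs) * G (j ∷ a) ((x ∸ j) ∷ b)) ≈ (if does (j ℕ.≟ c) then K j else 0#)
    headDigit j with does (j ℕ.≟ c)
    ... | true  = refl
    ... | false = trans (∑split-cong′ ms (λ _ _ → zeroˡ _)) (∑split-zero ms)
    <ᵇ-suc : ∀ c x → (c ℕ.<ᵇ suc x) ≡ (c ℕ.≤ᵇ x)
    <ᵇ-suc zero    x = ≡.refl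
    <ᵇ-suc (suc c) x = ≡.refl
    tailDigits : ∀ b → (if b then K c else 0#) ≈ (if b ∧ (cs ≤ᵛᵇ ms) then G (c ∷ cs) ((x ∸ c) ∷ (ms ∸ᵛ cs)) else 0#)
    tailDigits true  = ∑split-δ ms cs _
    tailDigits false = refl

module PowerSeries {c ℓ} (S : CommutativeRing c ℓ) (p : ℕ) where
  open CommutativeRing S
  open Sums S
  open Series S p
  open Convolution S p
  open ExponentVectors
  open import Relation.Binary.Reasoning.Setoid setoid
  open import Algebra.Properties.Group +-group using (ε⁻¹≈ε)

  ⊗-identityˡ : ∀ f → (oneS ⊗ f) ≐ f
  ⊗-identityˡ f m = begin
    ∑split m (λ a b → δ a 0ᵛ * f b)              ≈⟨ ∑split-δ m 0ᵛ (λ _ b → f b) ⟩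
    (if 0ᵛ ≤ᵛᵇ m then f (m ∸ᵛ 0ᵛ) else 0#)        ≡⟨ ≡.cong (λ b → if b then f (m ∸ᵛ 0ᵛ) else 0#) (0ᵛ≤ᵛᵇ m) ⟩
    f (m ∸ᵛ 0ᵛ)                                   ≡⟨ ≡.cong f (∸ᵛ-identityʳ m) ⟩
    f m                                           ∎

  ⊗-comm : ∀ f g → (f ⊗ g) ≐ (g ⊗ f)
  ⊗-comm f g m = trans (∑split-comm m _) (∑split-cong′ m (λ a b → *-comm (f b) (g a)))

  ⊗-assoc : ∀ f g h → ((f ⊗ g) ⊗ h) ≐ (f ⊗ (g ⊗ h))
  ⊗-assoc f g h m = begin
    ∑split m (λ ab c → ∑split ab (λ a b → f a * g b) * h c)   ≈⟨ ∑split-cong′ m (λ ab c → ∑-*ʳ (Series.splits S p ab) (h c) _) ⟩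
    ∑split m (λ ab c → ∑split ab (λ a b → f a * g b * h c))   ≈⟨ ∑split-assoc m (λ a b c → f a * g b * h c) ⟩
    ∑split m (λ a bc → ∑split bc (λ b c → f a * g b * h c))   ≈⟨ ∑split-cong′ m (λ a bc → ∑split-cong′ bc (λ b c → *-assoc (f a) (g b) (h c))) ⟩
    ∑split m (λ a bc → ∑split bc (λ b c → f a * (g b * h c))) ≈⟨ ∑split-cong′ m (λ a bc → ∑-*ˡ (Series.splits S p bc) (f a) _) ⟨
    ∑split m (λ a bc → f a * ∑split bc (λ b c → g b * h c))   ∎

  ⊗-cong : ∀ {f f′ g g′} → f ≐ f′ → g ≐ g′ → (f ⊗ g) ≐ (f′ ⊗ g′)
  ⊗-cong f≐f′ g≐g′ m = ∑split-cong′ m (λ a b → *-cong (f≐f′ a) (g≐g′ b))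

  ⊗-distribˡ : ∀ f g h → (f ⊗ (g ⊕ h)) ≐ ((f ⊗ g) ⊕ (f ⊗ h))
  ⊗-distribˡ f g h m = trans (∑split-cong′ m (λ a b → distribˡ (f a) (g b) (h b))) (∑-+ (Series.splits S p m) _ _)

  ⊗-distribʳ : ∀ f g h → ((g ⊕ h) ⊗ f) ≐ ((g ⊗ f) ⊕ (h ⊗ f))
  ⊗-distribʳ f g h m = trans (∑split-cong′ m (λ a b → distribʳ (f b) (g a) (h a))) (∑-+ (Series.splits S p m) _ _)

  ⊕-⊗-isCommutativeRing : IsCommutativeRing _≐_ _⊕_ _⊗_ ⊖_ zeroS oneS
  ⊕-⊗-isCommutativeRing = record
    { isRing = record
      { +-isAbelianGroup = record
        { isGroup = record
          { isMonoid = record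
            { isSemigroup = record
              { isMagma = record
                { isEquivalence = record
                  { refl = λ _ → refl ; sym = λ f≐g m → sym (f≐g m) ; trans = λ f≐g g≐h m → trans (f≐g m) (g≐h m) }
                ; ∙-cong = λ f≐f′ g≐g′ m → +-cong (f≐f′ m) (g≐g′ m) }
              ; assoc = λ f g h m → +-assoc (f m) (g m) (h m) }
            ; identity = (λ f m → +-identityˡ (f m)) , (λ f m → +-identityʳ (f m)) }
          ; inverse = (λ f m → -‿inverseˡ (f m)) , (λ f m → -‿inverseʳ (f m))
          ; ⁻¹-cong = λ f≐g m → -‿cong (f≐g m) }
        ; comm = λ f g m → +-comm (f m) (g m) }
      ; *-cong = ⊗-cong
      ; *-assoc = ⊗-assoc
      ; *-identity = ⊗-identityˡ , (λ f m → trans (⊗-comm f oneS m) (⊗-identityˡ f m))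
      ; distrib = ⊗-distribˡ , ⊗-distribʳ }
    ; *-comm = ⊗-comm }

  ⊕-⊗-commutativeRing : CommutativeRing c ℓ
  ⊕-⊗-commutativeRing = record { isCommutativeRing = ⊕-⊗-isCommutativeRing }

  sumS-apply : (fs : List PS) (m : Vec ℕ p) → sumS fs m ≡ ∑[ f ∈ fs ] f m
  sumS-apply []       m = ≡.refl
  sumS-apply (f ∷ fs) m = ≡.cong (f m +_) (sumS-apply fs m)

  constant : PS → Carrier
  constant f = f 0ᵛ

  constant-⊗ : ∀ f g → constant (f ⊗ g) ≈ constant f * constant g
  constant-⊗ f g = ∑split-0ᵛ (λ a b → f a * g b)

  constant-oneS : constant oneS ≈ 1#
  constant-oneS = reflexive (≡.cong (λ b → if b then 1# else 0#) (dec-true (Vecₚ.≡-dec ℕ._≟_ (0ᵛ {p}) 0ᵛ) ≡.refl))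

  constant-var : ∀ i → constant (var i) ≈ 0#
  constant-var i = reflexive (≡.cong (λ b → if b then 1# else 0#) (dec-false (Vecₚ.≡-dec ℕ._≟_ 0ᵛ (unitV i)) 0ᵛ≢unitᵛ))
    where
    0ᵛ≢unitᵛ : 0ᵛ ≢ unitV i
    0ᵛ≢unitᵛ 0ᵛ≡unitᵛ with ≡.trans (≡.sym (sum-0ᵛ p)) (≡.trans (≡.cong Vec.sum 0ᵛ≡unitᵛ) (sum-unitᵛ i))
    ... | ()

  constant-isRingHomomorphism : RingMorphisms.IsRingHomomorphism (CommutativeRing.rawRing ⊕-⊗-commutativeRing) rawRing constant
  constant-isRingHomomorphism = record
    { isSemiringHomomorphism = record
      { isNearSemiringHomomorphism = record
        { +-isMonoidHomomorphism = record
          { isMagmaHomomorphism = record { isRelHomomorphism = record { cong = λ f≐g → f≐g 0ᵛ } ; homo = λ _ _ → refl }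
          ; ε-homo = refl }
        ; *-homo = constant-⊗ }
      ; 1#-homo = constant-oneS }
    ; -‿homo = λ _ → refl }

  private
    sum-split : ∀ {a b m : Vec ℕ p} → a +ᵛ b ≡ m → Vec.sum a ℕ.+ Vec.sum b ≡ Vec.sum m
    sum-split {a} {b} a+b≡m = ≡.trans (≡.sym (sum-+ᵛ a b)) (≡.cong Vec.sum a+b≡m)

    ⊗-vanishes : ∀ {f g} (P Q : Vec ℕ p → Set) (m : Vec ℕ p) →
                 (∀ a b → a +ᵛ b ≡ m → P a ⊎ Q b) → (∀ a → P a → f a ≈ 0#) → (∀ b → Q b → g b ≈ 0#) → (f ⊗ g) m ≈ 0#
    ⊗-vanishes {f} {g} P Q m cover f≈0 g≈0 = trans (∑split-cong m termVanishes) (∑split-zero m)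
      where
      termVanishes : ∀ a b → a +ᵛ b ≡ m → f a * g b ≈ 0#
      termVanishes a b a+b≡m with cover a b a+b≡m
      ... | inj₁ Pa = trans (*-congʳ (f≈0 a Pa)) (zeroˡ _)
      ... | inj₂ Qb = trans (*-congˡ (g≈0 b Qb)) (zeroʳ _)

  IsPoly-zeroS : IsPoly zeroS
  IsPoly-zeroS = 0 , λ _ _ → refl

  IsPoly-oneS : IsPoly oneS
  IsPoly-oneS = 0 , λ m 0<|m| →
    reflexive (≡.cong (λ b → if b then 1# else 0#)
      (dec-false (Vecₚ.≡-dec ℕ._≟_ m 0ᵛ) (λ m≡0 → ℕₚ.<-irrefl (≡.sym (≡.trans (≡.cong Vec.sum m≡0) (sum-0ᵛ p))) 0<|m|)))

  IsPoly-var : ∀ i → IsPoly (var i)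
  IsPoly-var i = 1 , λ m 1<|m| →
    reflexive (≡.cong (λ b → if b then 1# else 0#)
      (dec-false (Vecₚ.≡-dec ℕ._≟_ m (unitV i)) (λ m≡eᵢ → ℕₚ.<-irrefl (≡.sym (≡.trans (≡.cong Vec.sum m≡eᵢ) (sum-unitᵛ i))) 1<|m|)))

  IsPoly-⊕ : ∀ {f g} → IsPoly f → IsPoly g → IsPoly (f ⊕ g)
  IsPoly-⊕ (B₁ , f≈0) (B₂ , g≈0) = B₁ ℕ.⊔ B₂ , λ m B<|m| →
    trans (+-cong (f≈0 m (ℕₚ.≤-<-trans (ℕₚ.m≤m⊔n B₁ B₂) B<|m|)) (g≈0 m (ℕₚ.≤-<-trans (ℕₚ.m≤n⊔m B₁ B₂) B<|m|))) (+-identityʳ 0#)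

  IsPoly-⊖ : ∀ {f} → IsPoly f → IsPoly (⊖ f)
  IsPoly-⊖ (B , f≈0) = B , λ m B<|m| → trans (-‿cong (f≈0 m B<|m|)) ε⁻¹≈ε

  IsPoly-⊗ : ∀ {f g} → IsPoly f → IsPoly g → IsPoly (f ⊗ g)
  IsPoly-⊗ (B₁ , f≈0) (B₂ , g≈0) = B₁ ℕ.+ B₂ , λ m B<|m| →
    ⊗-vanishes (λ a → B₁ < Vec.sum a) (λ b → B₂ < Vec.sum b) m (cover m B<|m|) f≈0 g≈0
    where
    cover : ∀ m → B₁ ℕ.+ B₂ < Vec.sum m → ∀ a b → a +ᵛ b ≡ m → B₁ < Vec.sum a ⊎ B₂ < Vec.sum b
    cover m B<|m| a b a+b≡m with B₁ ℕ.<? Vec.sum a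
    ... | yes B₁<|a| = inj₁ B₁<|a|
    ... | no  B₁≮|a| = inj₂ (ℕₚ.+-cancelˡ-< B₁ _ _ (ℕₚ.<-≤-trans (≡.subst (B₁ ℕ.+ B₂ <_) (≡.sym (sum-split a+b≡m)) B<|m|)
                                                                (ℕₚ.+-monoˡ-≤ (Vec.sum b) (ℕₚ.≮⇒≥ B₁≮|a|))))

  IsPoly-sumS : ∀ {a} {A : Set a} (F : A → PS) (xs : List A) → (∀ x → IsPoly (F x)) → IsPoly (sumS (map F xs))
  IsPoly-sumS F []       _      = IsPoly-zeroS
  IsPoly-sumS F (x ∷ xs) F-poly = IsPoly-⊕ (F-poly x) (IsPoly-sumS F xs F-poly)

  VanishesBelow : ℕ → PS → Set ℓ
  VanishesBelow n f = ∀ m → Vec.sum m < n → f m ≈ 0#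

  VanishesBelow-⊗ : ∀ {f g} m n → VanishesBelow m f → VanishesBelow n g → VanishesBelow (m ℕ.+ n) (f ⊗ g)
  VanishesBelow-⊗ m n f≈0 g≈0 v |v|<m+n = ⊗-vanishes (λ a → Vec.sum a < m) (λ b → Vec.sum b < n) v cover f≈0 g≈0
    where
    cover : ∀ a b → a +ᵛ b ≡ v → Vec.sum a < m ⊎ Vec.sum b < n
    cover a b a+b≡v with Vec.sum a ℕ.<? m
    ... | yes |a|<m = inj₁ |a|<m
    ... | no  |a|≮m = inj₂ (ℕₚ.+-cancelˡ-< m _ _ (ℕₚ.≤-<-trans (ℕₚ.+-monoˡ-≤ (Vec.sum b) (ℕₚ.≮⇒≥ |a|≮m))
                                                              (≡.subst (_< m ℕ.+ n) (≡.sym (sum-split a+b≡v)) |v|<m+n)))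

-- The coefficient of ∑ₙ (1 - d)ⁿ at m is already that of the partial sum up to |m|,
-- because (1 - d)ⁿ vanishes below degree n.
module UnitInverse {c ℓ} (S : CommutativeRing c ℓ) (p : ℕ) (d : Series.PS S p)
                   (constant-d : CommutativeRing._≈_ S (PowerSeries.constant S p d) (CommutativeRing.1# S)) where
  private
    module S = CommutativeRing S
  open Series S p using (PS)
  open PowerSeries S p using (⊕-⊗-commutativeRing; VanishesBelow; VanishesBelow-⊗; constant-oneS)
  open Convolution S p using (∑split-cong)
  open ExponentVectors
  open CommutativeRing ⊕-⊗-commutativeRing
  open import Algebra.Properties.AbelianGroup +-abelianGroup using (xyx⁻¹≈y)
  open import Relation.Binary.Reasoning.Setoid setoid

  private
    e : PS
    e = 1# - d

    d+e≈1 : d + e ≈ 1#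
    d+e≈1 = trans (sym (+-assoc d 1# (- d))) (xyx⁻¹≈y d 1#)

    e-vanishes : VanishesBelow 1 e
    e-vanishes m |m|<1 rewrite sum≡0⇒≡0ᵛ m (ℕₚ.n<1⇒n≡0 |m|<1) =
      S.trans (S.+-cong constant-oneS (S.-‿cong constant-d)) (S.-‿inverseʳ S.1#)

    power : ℕ → PS
    power zero    = 1#
    power (suc n) = e * power n

    power-vanishes : ∀ n → VanishesBelow n (power n)
    power-vanishes zero    m ()
    power-vanishes (suc n) = VanishesBelow-⊗ 1 n e-vanishes (power-vanishes n)

    geometric : ℕ → PS
    geometric zero    = 1#
    geometric (suc n) = geometric n + power (suc n)

    telescope : ∀ N → d * geometric N + power (suc N) ≈ 1#
    telescope zero = begin
      d * 1# + e * 1#  ≈⟨ distribʳ 1# d e ⟨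
      (d + e) * 1#     ≈⟨ *-identityʳ (d + e) ⟩
      d + e            ≈⟨ d+e≈1 ⟩
      1#               ∎
    telescope (suc N) = begin
      d * (geometric N + P) + e * P    ≈⟨ +-congʳ (distribˡ d (geometric N) P) ⟩
      d * geometric N + d * P + e * P  ≈⟨ +-assoc _ _ _ ⟩
      d * geometric N + (d * P + e * P) ≈⟨ +-congˡ (distribʳ P d e) ⟨
      d * geometric N + (d + e) * P    ≈⟨ +-congˡ (trans (*-congʳ d+e≈1) (*-identityˡ P)) ⟩
      d * geometric N + P              ≈⟨ telescope N ⟩
      1#                               ∎
      where
      P = power (suc N)

    geometric-stable : ∀ N j m → Vec.sum m ≤ N → geometric (N ℕ.+ j) m S.≈ geometric N m
    geometric-stable N zero    m _     = S.reflexive (≡.cong (λ k → geometric k m) (ℕₚ.+-identityʳ N))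
    geometric-stable N (suc j) m |m|≤N =
      S.trans (S.reflexive (≡.cong (λ k → geometric k m) (ℕₚ.+-suc N j)))
              (S.trans (S.+-congˡ (power-vanishes (suc (N ℕ.+ j)) m (s≤s (ℕₚ.≤-trans |m|≤N (ℕₚ.m≤m+n N j)))))
                       (S.trans (S.+-identityʳ _) (geometric-stable N j m |m|≤N)))

  d⁻¹ : PS
  d⁻¹ m = geometric (Vec.sum m) m

  d*d⁻¹≈1 : d * d⁻¹ ≈ 1#
  d*d⁻¹≈1 m = S.trans (∑split-cong m truncate) (S.trans (S.sym (S.+-identityʳ _)) (S.trans (S.+-congˡ (S.sym tail≈0)) (telescope |m| m)))
    where
    |m| = Vec.sum m
    tail≈0 : power (suc |m|) m S.≈ S.0#
    tail≈0 = power-vanishes (suc |m|) m (ℕₚ.n<1+n |m|)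
    truncate : ∀ a b → a +ᵛ b ≡ m → d a S.* d⁻¹ b S.≈ d a S.* geometric |m| b
    truncate a b a+b≡m = S.*-congˡ (S.sym (S.trans (S.reflexive (≡.cong (λ k → geometric k b) |m|≡|b|+|a|))
                                                     (geometric-stable (Vec.sum b) (Vec.sum a) b ℕₚ.≤-refl)))
      where
      |m|≡|b|+|a| : |m| ≡ Vec.sum b ℕ.+ Vec.sum a
      |m|≡|b|+|a| = ≡.trans (≡.cong Vec.sum (≡.sym a+b≡m)) (≡.trans (sum-+ᵛ a b) (ℕₚ.+-comm (Vec.sum a) (Vec.sum b)))

module SquareMatrices {c ℓ} (T : CommutativeRing c ℓ) where
  open CommutativeRing T
  open Sums T
  open import Algebra.Properties.Ring ring using (-‿distribˡ-*; -‿distribʳ-*)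
  open import Algebra.Properties.CommutativeSemigroup *-commutativeSemigroup using (x∙yz≈y∙xz)
  open import Relation.Binary.Reasoning.Setoid setoid

  private
    variable
      k : ℕ
      a : Level
      A : Set a

  Matrix : ℕ → Set c
  Matrix k = Fin k → Fin k → Carrier

  infix 4 _≋_
  infixl 7 _·_

  _≋_ : Matrix k → Matrix k → Set ℓ
  M ≋ N = ∀ u v → M u v ≈ N u v

  _·_ : Matrix k → Matrix k → Matrix k
  _·_ {k} M N u v = ∑[ w ∈ allFin k ] (M u w * N w v)

  scalar : Carrier → Matrix k
  scalar x u v = if does (u Fin.≟ v) then x else 0#

  ∑-scalarˡ : ∀ x (u : Fin k) (f : Fin k → Carrier) → ∑[ v ∈ allFin k ] (scalar x u v * f v) ≈ x * f u
  ∑-scalarˡ {suc k} x Fin.zero f = begin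
    ∑[ v ∈ allFin (suc k) ] (scalar x Fin.zero v * f v)  ≡⟨ ∑-allFin-suc (λ v → scalar x Fin.zero v * f v) ⟩
    x * f Fin.zero + ∑[ v ∈ allFin k ] (0# * f (Fin.suc v)) ≈⟨ +-congˡ (trans (∑-cong (allFin k) (λ v → zeroˡ _)) (∑-zero (allFin k))) ⟩
    x * f Fin.zero + 0#                                   ≈⟨ +-identityʳ _ ⟩
    x * f Fin.zero                                        ∎
  ∑-scalarˡ {suc k} x (Fin.suc u) f = begin
    ∑[ v ∈ allFin (suc k) ] (scalar x (Fin.suc u) v * f v)  ≡⟨ ∑-allFin-suc (λ v → scalar x (Fin.suc u) v * f v) ⟩
    0# * f Fin.zero + ∑[ v ∈ allFin k ] (scalar x u v * f (Fin.suc v)) ≈⟨ +-cong (zeroˡ _) (∑-scalarˡ x u (λ v → f (Fin.suc v))) ⟩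
    0# + x * f (Fin.suc u)                                  ≈⟨ +-identityˡ _ ⟩
    x * f (Fin.suc u)                                       ∎

  scalar-sym : ∀ x (u v : Fin k) → scalar x u v ≡ scalar x v u
  scalar-sym x Fin.zero    Fin.zero    = ≡.refl
  scalar-sym x Fin.zero    (Fin.suc v) = ≡.refl
  scalar-sym x (Fin.suc u) Fin.zero    = ≡.refl
  scalar-sym x (Fin.suc u) (Fin.suc v) = scalar-sym x u v

  ∑-scalarʳ : ∀ x (w : Fin k) (f : Fin k → Carrier) → ∑[ u ∈ allFin k ] (f u * scalar x u w) ≈ f w * x
  ∑-scalarʳ {k} x w f = begin
    ∑[ u ∈ allFin k ] (f u * scalar x u w) ≈⟨ ∑-cong (allFin k) (λ u → trans (*-comm _ _) (reflexive (≡.cong (_* f u) (scalar-sym x u w)))) ⟩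
    ∑[ u ∈ allFin k ] (scalar x w u * f u) ≈⟨ ∑-scalarˡ x w f ⟩
    x * f w                                ≈⟨ *-comm x (f w) ⟩
    f w * x                                ∎

  *-scalar : ∀ y x (u v : Fin k) → y * scalar x u v ≈ scalar (y * x) u v
  *-scalar y x u v with does (u Fin.≟ v)
  ... | true  = refl
  ... | false = zeroʳ y

  ∑-*-∑ : ∀ (us : List A) {b} {B : Set b} (vs : List B) (f : A → Carrier) (M : A → B → Carrier) (g : B → Carrier) →
          ∑[ u ∈ us ] (f u * ∑[ v ∈ vs ] (M u v * g v)) ≈ ∑[ v ∈ vs ] (∑[ u ∈ us ] (f u * M u v) * g v)
  ∑-*-∑ us vs f M g = begin
    ∑[ u ∈ us ] (f u * ∑[ v ∈ vs ] (M u v * g v))   ≈⟨ ∑-cong us (λ u → ∑-*ˡ vs (f u) _) ⟩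
    ∑[ u ∈ us ] ∑[ v ∈ vs ] (f u * (M u v * g v))   ≈⟨ ∑-swap us vs _ ⟩
    ∑[ v ∈ vs ] ∑[ u ∈ us ] (f u * (M u v * g v))   ≈⟨ ∑-cong vs (λ v → ∑-cong us (λ u → sym (*-assoc _ _ _))) ⟩
    ∑[ v ∈ vs ] ∑[ u ∈ us ] (f u * M u v * g v)     ≈⟨ ∑-cong vs (λ v → ∑-*ʳ us (g v) _) ⟨
    ∑[ v ∈ vs ] (∑[ u ∈ us ] (f u * M u v) * g v)   ∎

  ∑-*ˡ-inner : ∀ (us : List A) x (f g : A → Carrier) → ∑[ u ∈ us ] (f u * (x * g u)) ≈ x * ∑[ u ∈ us ] (f u * g u)
  ∑-*ˡ-inner us x f g = trans (∑-cong us (λ u → x∙yz≈y∙xz (f u) x (g u))) (sym (∑-*ˡ us x _))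

  ∑-*ʳ-inner : ∀ (us : List A) x (f g : A → Carrier) → ∑[ u ∈ us ] (x * g u * f u) ≈ x * ∑[ u ∈ us ] (g u * f u)
  ∑-*ʳ-inner us x f g = trans (∑-cong us (λ u → *-assoc x (g u) (f u))) (sym (∑-*ˡ us x _))

  ∑-linearʳ : ∀ (ws : List A) α x (f g h : A → Carrier) →
              ∑[ w ∈ ws ] ((α * f w - x * g w) * h w) ≈ α * ∑[ w ∈ ws ] (f w * h w) - x * ∑[ w ∈ ws ] (g w * h w)
  ∑-linearʳ ws α x f g h = begin
    ∑[ w ∈ ws ] ((α * f w - x * g w) * h w)                    ≈⟨ ∑-cong ws (λ w → trans (distribʳ _ _ _) (+-congˡ (sym (-‿distribˡ-* _ _)))) ⟩
    ∑[ w ∈ ws ] (α * f w * h w + - (x * g w * h w))            ≈⟨ ∑-+ ws _ _ ⟩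
    ∑[ w ∈ ws ] (α * f w * h w) + ∑[ w ∈ ws ] (- (x * g w * h w)) ≈⟨ +-congˡ (∑-neg ws _) ⟨
    ∑[ w ∈ ws ] (α * f w * h w) - ∑[ w ∈ ws ] (x * g w * h w)  ≈⟨ +-cong (∑-*ʳ-inner ws α h f) (-‿cong (∑-*ʳ-inner ws x h g)) ⟩
    α * ∑[ w ∈ ws ] (f w * h w) - x * ∑[ w ∈ ws ] (g w * h w)  ∎

  ∑-linearˡ : ∀ (vs : List A) α y (f g h : A → Carrier) →
              ∑[ v ∈ vs ] (h v * (α * f v - g v * y)) ≈ α * ∑[ v ∈ vs ] (h v * f v) - ∑[ v ∈ vs ] (h v * g v) * y
  ∑-linearˡ vs α y f g h = begin
    ∑[ v ∈ vs ] (h v * (α * f v - g v * y))                      ≈⟨ ∑-cong vs (λ v → trans (distribˡ _ _ _) (+-congˡ (trans (sym (-‿distribʳ-* _ _)) (-‿cong (sym (*-assoc _ _ _)))))) ⟩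
    ∑[ v ∈ vs ] (h v * (α * f v) + - (h v * g v * y))            ≈⟨ ∑-+ vs _ _ ⟩
    ∑[ v ∈ vs ] (h v * (α * f v)) + ∑[ v ∈ vs ] (- (h v * g v * y)) ≈⟨ +-congˡ (∑-neg vs _) ⟨
    ∑[ v ∈ vs ] (h v * (α * f v)) - ∑[ v ∈ vs ] (h v * g v * y)  ≈⟨ +-cong (∑-*ˡ-inner vs α h f) (-‿cong (sym (∑-*ʳ vs y _))) ⟩
    α * ∑[ v ∈ vs ] (h v * f v) - ∑[ v ∈ vs ] (h v * g v) * y    ∎

  ∑-neg-*ˡ-inner : ∀ (us : List A) x (f g : A → Carrier) → ∑[ u ∈ us ] (f u * - (x * g u)) ≈ - (x * ∑[ u ∈ us ] (f u * g u))
  ∑-neg-*ˡ-inner us x f g = trans (∑-cong us (λ u → sym (-‿distribʳ-* _ _))) (trans (sym (∑-neg us _)) (-‿cong (∑-*ˡ-inner us x f g)))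

  ∑-neg-*ʳ-inner : ∀ (us : List A) x (f g : A → Carrier) → ∑[ u ∈ us ] (- (x * g u) * f u) ≈ - (x * ∑[ u ∈ us ] (g u * f u))
  ∑-neg-*ʳ-inner us x f g = trans (∑-cong us (λ u → sym (-‿distribˡ-* _ _))) (trans (sym (∑-neg us _)) (-‿cong (∑-*ʳ-inner us x f g)))

  ·-suc : (M N : Matrix (suc k)) (u v : Fin (suc k)) →
          (M · N) u v ≡ M u Fin.zero * N Fin.zero v + ∑[ w ∈ allFin k ] (M u (Fin.suc w) * N (Fin.suc w) v)
  ·-suc M N u v = ∑-allFin-suc (λ w → M u w * N w v)

  infixr 7 _▹_

  _▹_ : Matrix k → (Fin k → Carrier) → Fin k → Carrier
  _▹_ {k} M x u = ∑[ w ∈ allFin k ] (M u w * x w)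

  scale : Carrier → Matrix k → Matrix k
  scale y M u v = y * M u v

  scale-· : ∀ y (M N : Matrix k) → scale y M · N ≋ scale y (M · N)
  scale-· {k} y M N u v = trans (∑-cong (allFin k) (λ w → *-assoc y (M u w) (N w v))) (sym (∑-*ˡ (allFin k) y _))

  ·-scale : ∀ y (M N : Matrix k) → M · scale y N ≋ scale y (M · N)
  ·-scale {k} y M N u v = ∑-*ˡ-inner (allFin k) y (λ w → M u w) (λ w → N w v)

  scale-scalar : ∀ {d y} {M : Matrix k} → M ≋ scalar d → y * d ≈ 1# → scale y M ≋ scalar 1#
  scale-scalar {d = d} {y} M≋d yd≈1 u v with does (u Fin.≟ v) | M≋d u v
  ... | true  | Muv≈d = trans (*-congˡ Muv≈d) yd≈1
  ... | false | Muv≈0 = trans (*-congˡ Muv≈0) (zeroʳ y)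

  ▹-assoc : (M N : Matrix k) (x : Fin k → Carrier) → ∀ u → (M ▹ N ▹ x) u ≈ ((M · N) ▹ x) u
  ▹-assoc {k} M N x u = ∑-*-∑ (allFin k) (allFin k) (M u) N x

  scalar-1#-▹ : (x : Fin k → Carrier) → ∀ u → (scalar 1# ▹ x) u ≈ x u
  scalar-1#-▹ x u = trans (∑-scalarˡ 1# u x) (*-identityˡ (x u))

  left-inverse-solves : ∀ {M N : Matrix k} {x y : Fin k → Carrier} → N · M ≋ scalar 1# → (∀ u → (M ▹ x) u ≈ y u) → ∀ u → (N ▹ y) u ≈ x u
  left-inverse-solves {k} {M} {N} {x} {y} NM≋1 Mx≈y u = begin
    (N ▹ y) u               ≈⟨ ∑-cong (allFin k) (λ w → *-congˡ (Mx≈y w)) ⟨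
    (N ▹ M ▹ x) u           ≈⟨ ▹-assoc N M x u ⟩
    ((N · M) ▹ x) u         ≈⟨ ∑-cong (allFin k) (λ w → *-congʳ (NM≋1 u w)) ⟩
    (scalar 1# ▹ x) u       ≈⟨ scalar-1#-▹ x u ⟩
    x u                     ∎

  ∑-scalar-▹ : ∀ (is : List A) (f : A → Carrier) (g : A → Fin k) (x : Fin k → Carrier) →
               ∑[ w ∈ allFin k ] (∑[ i ∈ is ] scalar (f i) (g i) w * x w) ≈ ∑[ i ∈ is ] (f i * x (g i))
  ∑-scalar-▹ {k = k} is f g x = begin
    ∑[ w ∈ allFin k ] (∑[ i ∈ is ] scalar (f i) (g i) w * x w)   ≈⟨ ∑-cong (allFin k) (λ w → ∑-*ʳ is (x w) _) ⟩
    ∑[ w ∈ allFin k ] ∑[ i ∈ is ] (scalar (f i) (g i) w * x w)   ≈⟨ ∑-swap (allFin k) is _ ⟩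
    ∑[ i ∈ is ] ∑[ w ∈ allFin k ] (scalar (f i) (g i) w * x w)   ≈⟨ ∑-cong is (λ i → ∑-scalarˡ (f i) (g i) x) ⟩
    ∑[ i ∈ is ] (f i * x (g i))                                   ∎

  [1-M]▹ : (M : Matrix k) (x : Fin k → Carrier) → ∀ u → ((λ u v → scalar 1# u v - M u v) ▹ x) u ≈ x u - (M ▹ x) u
  [1-M]▹ {k} M x u = begin
    ∑[ w ∈ allFin k ] ((scalar 1# u w - M u w) * x w)                   ≈⟨ ∑-cong (allFin k) (λ w → trans (distribʳ _ _ _) (+-congˡ (sym (-‿distribˡ-* _ _)))) ⟩
    ∑[ w ∈ allFin k ] (scalar 1# u w * x w + - (M u w * x w))           ≈⟨ ∑-+ (allFin k) _ _ ⟩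
    (scalar 1# ▹ x) u + ∑[ w ∈ allFin k ] (- (M u w * x w))            ≈⟨ +-cong (scalar-1#-▹ x u) (sym (∑-neg (allFin k) _)) ⟩
    x u - (M ▹ x) u                                                     ∎

-- Division-free Gaussian elimination: the Schur complement of the corner a is scaled by a,
-- and quasiDet multiplies the successive pivots.
module QuasiAdjugate {c ℓ} (T : CommutativeRing c ℓ) where
  open CommutativeRing T
  open Sums T
  open SquareMatrices T
  open import Algebra.Properties.Ring ring using (-‿distribˡ-*; -‿distribʳ-*)
  open import Algebra.Properties.Group +-group using (//-rightDividesˡ; //-rightDividesʳ)
  open import Relation.Binary.Reasoning.Setoid setoid

  private
    variable
      k : ℕ

    cancel : ∀ {x y z} → x ≈ z - y → x + y - z ≈ 0#
    cancel {x} {y} {z} x≈z-y = trans (+-congʳ (trans (+-congʳ x≈z-y) (//-rightDividesˡ y z))) (-‿inverseʳ z)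

  schurComplement : Matrix (suc k) → Matrix k
  schurComplement M u w = M Fin.zero Fin.zero * M (Fin.suc u) (Fin.suc w) - M (Fin.suc u) Fin.zero * M Fin.zero (Fin.suc w)

  module Bordering {k} (M : Matrix (suc k)) (d′ : Carrier) (B′ : Matrix k) where
    private
      ws = allFin k

    corner : Carrier
    corner = M Fin.zero Fin.zero

    row col : Fin k → Carrier
    row w = M Fin.zero (Fin.suc w)
    col u = M (Fin.suc u) Fin.zero

    minor : Matrix k
    minor u w = M (Fin.suc u) (Fin.suc w)

    rowB′ B′col : Fin k → Carrier
    rowB′ w = ∑[ u ∈ ws ] (row u * B′ u w)
    B′col u = ∑[ w ∈ ws ] (B′ u w * col w)

    rowB′col : Carrier
    rowB′col = ∑[ u ∈ ws ] (row u * B′col u)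

    bordered : Matrix (suc k)
    bordered Fin.zero    Fin.zero    = d′ + rowB′col
    bordered Fin.zero    (Fin.suc w) = - (corner * rowB′ w)
    bordered (Fin.suc u) Fin.zero    = - (corner * B′col u)
    bordered (Fin.suc u) (Fin.suc w) = corner * corner * B′ u w

    private
      a = corner
      A′ = schurComplement M

    rowB′col-assoc : ∑[ w ∈ ws ] (rowB′ w * col w) ≈ rowB′col
    rowB′col-assoc = sym (∑-*-∑ ws ws row B′ col)

    ·-bordered : A′ · B′ ≋ scalar d′ → M · bordered ≋ scalar (a * d′)
    ·-bordered A′B′≋d′ Fin.zero Fin.zero = begin
      (M · bordered) Fin.zero Fin.zero ≡⟨ ·-suc M bordered Fin.zero Fin.zero ⟩
      a * (d′ + rowB′col) + ∑[ u ∈ ws ] (row u * - (a * B′col u)) ≈⟨ +-cong (distribˡ a d′ rowB′col) (∑-neg-*ˡ-inner ws a row B′col) ⟩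
      a * d′ + a * rowB′col - a * rowB′col                         ≈⟨ //-rightDividesʳ (a * rowB′col) (a * d′) ⟩
      a * d′                                                       ∎
    ·-bordered A′B′≋d′ Fin.zero (Fin.suc w) = begin
      (M · bordered) Fin.zero (Fin.suc w) ≡⟨ ·-suc M bordered Fin.zero (Fin.suc w) ⟩
      a * - (a * rowB′ w) + ∑[ u ∈ ws ] (row u * (a * a * B′ u w)) ≈⟨ +-cong (trans (sym (-‿distribʳ-* _ _)) (-‿cong (sym (*-assoc _ _ _)))) (∑-*ˡ-inner ws (a * a) row (λ u → B′ u w)) ⟩
      - (a * a * rowB′ w) + a * a * rowB′ w                         ≈⟨ -‿inverseˡ _ ⟩
      0#                                                            ∎
    ·-bordered A′B′≋d′ (Fin.suc u) Fin.zero = begin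
      (M · bordered) (Fin.suc u) Fin.zero ≡⟨ ·-suc M bordered (Fin.suc u) Fin.zero ⟩
      col u * (d′ + rowB′col) + ∑[ w ∈ ws ] (minor u w * - (a * B′col w))
        ≈⟨ +-cong (distribˡ (col u) d′ rowB′col) (∑-neg-*ˡ-inner ws a (minor u) B′col) ⟩
      col u * d′ + col u * rowB′col - a * ∑[ w ∈ ws ] (minor u w * B′col w)
        ≈⟨ cancel (trans (*-comm (col u) d′) (trans (sym (∑-scalarˡ d′ u col)) (trans (∑-cong ws (λ v → *-congʳ (sym (A′B′≋d′ u v))))
                    (trans (sym (∑-*-∑ ws ws (A′ u) B′ col)) (∑-linearʳ ws a (col u) (minor u) row B′col))))) ⟩
      0#
        ∎
    ·-bordered A′B′≋d′ (Fin.suc u) (Fin.suc w) = begin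
      (M · bordered) (Fin.suc u) (Fin.suc w) ≡⟨ ·-suc M bordered (Fin.suc u) (Fin.suc w) ⟩
      col u * - (a * rowB′ w) + ∑[ v ∈ ws ] (minor u v * (a * a * B′ v w))
        ≈⟨ +-cong (trans (sym (-‿distribʳ-* _ _)) (-‿cong (x∙yz≈y∙xz (col u) a (rowB′ w))))
                  (trans (∑-*ˡ-inner ws (a * a) (minor u) (λ v → B′ v w)) (*-assoc a a _)) ⟩
      - (a * (col u * rowB′ w)) + a * (a * ∑[ v ∈ ws ] (minor u v * B′ v w))
        ≈⟨ trans (+-comm _ _) (+-congˡ (-‿distribʳ-* a _)) ⟩
      a * (a * ∑[ v ∈ ws ] (minor u v * B′ v w)) + a * - (col u * rowB′ w)
        ≈⟨ distribˡ a _ _ ⟨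
      a * (a * ∑[ v ∈ ws ] (minor u v * B′ v w) - col u * rowB′ w)
        ≈⟨ *-congˡ (sym (∑-linearʳ ws a (col u) (minor u) row (λ v → B′ v w))) ⟩
      a * (A′ · B′) u w
        ≈⟨ trans (*-congˡ (A′B′≋d′ u w)) (*-scalar a d′ u w) ⟩
      scalar (a * d′) u w
        ∎
      where open import Algebra.Properties.CommutativeSemigroup *-commutativeSemigroup using (x∙yz≈y∙xz)

    bordered-· : B′ · A′ ≋ scalar d′ → bordered · M ≋ scalar (a * d′)
    bordered-· B′A′≋d′ Fin.zero Fin.zero = begin
      (bordered · M) Fin.zero Fin.zero ≡⟨ ·-suc bordered M Fin.zero Fin.zero ⟩
      (d′ + rowB′col) * a + ∑[ w ∈ ws ] (- (a * rowB′ w) * col w) ≈⟨ +-cong (trans (*-comm _ a) (distribˡ a d′ rowB′col)) (trans (∑-neg-*ʳ-inner ws a col rowB′) (-‿cong (*-congˡ rowB′col-assoc))) ⟩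
      a * d′ + a * rowB′col - a * rowB′col                          ≈⟨ //-rightDividesʳ (a * rowB′col) (a * d′) ⟩
      a * d′                                                        ∎
    bordered-· B′A′≋d′ Fin.zero (Fin.suc w) = begin
      (bordered · M) Fin.zero (Fin.suc w) ≡⟨ ·-suc bordered M Fin.zero (Fin.suc w) ⟩
      (d′ + rowB′col) * row w + ∑[ v ∈ ws ] (- (a * rowB′ v) * minor v w)
        ≈⟨ +-cong (distribʳ (row w) d′ rowB′col) (∑-neg-*ʳ-inner ws a (λ v → minor v w) rowB′) ⟩
      d′ * row w + rowB′col * row w - a * ∑[ v ∈ ws ] (rowB′ v * minor v w)
        ≈⟨ cancel (trans (*-comm d′ (row w)) (trans (sym (∑-scalarʳ d′ w row)) (trans (∑-cong ws (λ u → *-congˡ (sym (B′A′≋d′ u w))))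
                    (trans (∑-*-∑ ws ws row B′ (λ v → A′ v w))
                      (trans (∑-linearˡ ws a (row w) (λ v → minor v w) col rowB′) (+-congˡ (-‿cong (*-congʳ rowB′col-assoc)))))))) ⟩
      0#
        ∎
    bordered-· B′A′≋d′ (Fin.suc u) Fin.zero = begin
      (bordered · M) (Fin.suc u) Fin.zero ≡⟨ ·-suc bordered M (Fin.suc u) Fin.zero ⟩
      - (a * B′col u) * a + ∑[ v ∈ ws ] (a * a * B′ u v * col v) ≈⟨ +-cong (trans (sym (-‿distribˡ-* _ _)) (-‿cong (trans (*-comm _ a) (sym (*-assoc _ _ _))))) (∑-*ʳ-inner ws (a * a) col (B′ u)) ⟩
      - (a * a * B′col u) + a * a * B′col u                        ≈⟨ -‿inverseˡ _ ⟩
      0#                                                            ∎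
    bordered-· B′A′≋d′ (Fin.suc u) (Fin.suc w) = begin
      (bordered · M) (Fin.suc u) (Fin.suc w) ≡⟨ ·-suc bordered M (Fin.suc u) (Fin.suc w) ⟩
      - (a * B′col u) * row w + ∑[ v ∈ ws ] (a * a * B′ u v * minor v w)
        ≈⟨ +-cong (trans (sym (-‿distribˡ-* _ _)) (-‿cong (*-assoc a (B′col u) (row w))))
                  (trans (∑-*ʳ-inner ws (a * a) (λ v → minor v w) (B′ u)) (*-assoc a a _)) ⟩
      - (a * (B′col u * row w)) + a * (a * ∑[ v ∈ ws ] (B′ u v * minor v w))
        ≈⟨ trans (+-comm _ _) (+-congˡ (-‿distribʳ-* a _)) ⟩
      a * (a * ∑[ v ∈ ws ] (B′ u v * minor v w)) + a * - (B′col u * row w)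
        ≈⟨ distribˡ a _ _ ⟨
      a * (a * ∑[ v ∈ ws ] (B′ u v * minor v w) - B′col u * row w)
        ≈⟨ *-congˡ (sym (∑-linearˡ ws a (row w) (λ v → minor v w) col (B′ u))) ⟩
      a * (B′ · A′) u w
        ≈⟨ trans (*-congˡ (B′A′≋d′ u w)) (*-scalar a d′ u w) ⟩
      scalar (a * d′) u w
        ∎

  quasiDet : Matrix k → Carrier
  quasiDet {zero}  M = 1#
  quasiDet {suc k} M = M Fin.zero Fin.zero * quasiDet (schurComplement M)

  quasiAdj : Matrix k → Matrix k
  quasiAdj {zero}  M = λ ()
  quasiAdj {suc k} M = Bordering.bordered M (quasiDet (schurComplement M)) (quasiAdj (schurComplement M))

  ·-quasiAdj : (M : Matrix k) → M · quasiAdj M ≋ scalar (quasiDet M)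
  ·-quasiAdj {zero}  M ()
  ·-quasiAdj {suc k} M = Bordering.·-bordered M _ _ (·-quasiAdj (schurComplement M))

  quasiAdj-· : (M : Matrix k) → quasiAdj M · M ≋ scalar (quasiDet M)
  quasiAdj-· {zero}  M ()
  quasiAdj-· {suc k} M = Bordering.bordered-· M _ _ (quasiAdj-· (schurComplement M))

  module _ {c′ ℓ′} (U : CommutativeRing c′ ℓ′) {h : Carrier → CommutativeRing.Carrier U}
           (h-isRingHomomorphism : RingMorphisms.IsRingHomomorphism rawRing (CommutativeRing.rawRing U) h) where
    private
      module U = CommutativeRing U
      module MU = SquareMatrices U
    open RingMorphisms.IsRingHomomorphism h-isRingHomomorphism
    open import Algebra.Properties.Group U.+-group using (ε⁻¹≈ε)

    quasiDet-homo-1# : (M : Matrix k) → (∀ u v → h (M u v) U.≈ MU.scalar U.1# u v) → h (quasiDet M) U.≈ U.1#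
    quasiDet-homo-1# {zero}  M _    = 1#-homo
    quasiDet-homo-1# {suc k} M M↦I =
      U.trans (*-homo _ _) (U.trans (U.*-cong (M↦I Fin.zero Fin.zero) (quasiDet-homo-1# (schurComplement M) complement↦I)) (U.*-identityˡ U.1#))
      where
      complement↦I : ∀ u w → h (schurComplement M u w) U.≈ MU.scalar U.1# u w
      complement↦I u w = U.trans (+-homo _ _) (U.trans (U.+-cong
        (U.trans (*-homo _ _) (U.trans (U.*-cong (M↦I Fin.zero Fin.zero) (M↦I (Fin.suc u) (Fin.suc w))) (U.*-identityˡ _)))
        (U.trans (-‿homo _) (U.trans (U.-‿cong (U.trans (*-homo _ _) (U.trans (U.*-congʳ (M↦I (Fin.suc u) Fin.zero)) (U.zeroˡ _)))) ε⁻¹≈ε)))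
        (U.+-identityʳ _))

module BaseDigits (p : ℕ) .{{_ : NonZero p}} (2≤p : 2 ≤ p) where
  open import Data.Nat using (_+_; _*_)
  open Digits p
  open ExponentVectors

  private
    div<self : ∀ n → suc n div p ≤ n
    div<self n = ℕₚ.≤-pred (m/n<m (suc n) p 2≤p)

  digitsAux-fuel : ∀ f f′ x → x ≤ f → x ≤ f′ → digitsAux f x ≡ digitsAux f′ x
  digitsAux-fuel zero    zero     zero    _         _          = ≡.refl
  digitsAux-fuel zero    (suc f′) zero    _         _          = ≡.refl
  digitsAux-fuel (suc f) zero     zero    _         _          = ≡.refl
  digitsAux-fuel (suc f) (suc f′) zero    _         _          = ≡.refl
  digitsAux-fuel (suc f) (suc f′) (suc x) (s≤s x≤f) (s≤s x≤f′) =
    ≡.cong ((suc x mod p) ∷_) (digitsAux-fuel f f′ (suc x div p) (ℕₚ.≤-trans (div<self x) x≤f) (ℕₚ.≤-trans (div<self x) x≤f′))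

  digits-suc : ∀ n → digits (suc n) ≡ (suc n mod p) ∷ digits (suc n div p)
  digits-suc n = ≡.cong ((suc n mod p) ∷_) (digitsAux-fuel n (suc n div p) (suc n div p) (div<self n) ℕₚ.≤-refl)

  private
    p*q+i≡i+q*p : ∀ q (i : Fin p) → p * q + toℕ i ≡ toℕ i + q * p
    p*q+i≡i+q*p q i = ≡.trans (ℕₚ.+-comm (p * q) (toℕ i)) (≡.cong (toℕ i +_) (ℕₚ.*-comm p q))

  [p*q+i]mod-p : ∀ q (i : Fin p) → (p * q + toℕ i) mod p ≡ i
  [p*q+i]mod-p q i = Finₚ.toℕ-injective (≡.trans (Finₚ.toℕ-fromℕ< _) (begin
    (p * q + toℕ i) % p  ≡⟨ %-congˡ (p*q+i≡i+q*p q i) ⟩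
    (toℕ i + q * p) % p  ≡⟨ [m+kn]%n≡m%n (toℕ i) q p ⟩
    toℕ i % p            ≡⟨ m<n⇒m%n≡m (Finₚ.toℕ<n i) ⟩
    toℕ i                ∎))
    where open ≡.≡-Reasoning

  [p*q+i]div-p : ∀ q (i : Fin p) → (p * q + toℕ i) div p ≡ q
  [p*q+i]div-p q i = begin
    (p * q + toℕ i) / p          ≡⟨ /-congˡ (p*q+i≡i+q*p q i) ⟩
    (toℕ i + q * p) / p          ≡⟨ +-distrib-/ (toℕ i) (q * p) remainders<p ⟩
    toℕ i / p + q * p / p        ≡⟨ ≡.cong₂ _+_ (m<n⇒m/n≡0 (Finₚ.toℕ<n i)) (m*n/n≡m q p) ⟩
    q                            ∎
    where
    open ≡.≡-Reasoning
    remainders<p : toℕ i % p + (q * p) % p < p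
    remainders<p = ≡.subst (_< p) (≡.sym (≡.cong₂ _+_ (m<n⇒m%n≡m (Finₚ.toℕ<n i)) (m*n%n≡0 q p)))
                           (≡.subst (_< p) (≡.sym (ℕₚ.+-identityʳ (toℕ i))) (Finₚ.toℕ<n i))

  digits-step : ∀ q (i : Fin p) → 0 < p * q + toℕ i → digits (p * q + toℕ i) ≡ i ∷ digits q
  digits-step q i 0<n with p * q + toℕ i in n≡ | 0<n
  ... | suc n | _ = ≡.trans (digits-suc n)
    (≡.cong₂ _∷_ (≡.subst (λ m → m mod p ≡ i) n≡ ([p*q+i]mod-p q i)) (≡.cong digits (≡.subst (λ m → m div p ≡ q) n≡ ([p*q+i]div-p q i))))

  digitCount : List (Fin p) → Vec ℕ p
  digitCount ds = tabulate (λ j → length (filter (Fin._≟ j) ds))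

  digitCount-[] : digitCount [] ≡ 0ᵛ
  digitCount-[] = ≡-byLookup (λ j → ≡.trans (Vecₚ.lookup∘tabulate _ j) (≡.sym (Vecₚ.lookup-replicate j 0)))

  digitCount-∷ : ∀ i ds → digitCount (i ∷ ds) ≡ unitᵛ i +ᵛ digitCount ds
  digitCount-∷ i ds = ≡-byLookup λ j → begin
    Vec.lookup (digitCount (i ∷ ds)) j                         ≡⟨ Vecₚ.lookup∘tabulate _ j ⟩
    length (filter (Fin._≟ j) (i ∷ ds))                        ≡⟨ length-filter-∷ j ⟩
    (if does (i Fin.≟ j) then 1 else 0) + length (filter (Fin._≟ j) ds)
                                                               ≡⟨ ≡.cong₂ _+_ (lookup-unitᵛ i j) (Vecₚ.lookup∘tabulate _ j) ⟨
    Vec.lookup (unitᵛ i) j + Vec.lookup (digitCount ds) j      ≡⟨ Vecₚ.lookup-zipWith _+_ j (unitᵛ i) (digitCount ds) ⟨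
    Vec.lookup (unitᵛ i +ᵛ digitCount ds) j                    ∎
    where
    open ≡.≡-Reasoning
    length-filter-∷ : ∀ j → length (filter (Fin._≟ j) (i ∷ ds)) ≡ (if does (i Fin.≟ j) then 1 else 0) + length (filter (Fin._≟ j) ds)
    length-filter-∷ j with does (i Fin.≟ j)
    ... | true  = ≡.refl
    ... | false = ≡.refl

  sum-digitCount : ∀ ds → Vec.sum (digitCount ds) ≡ length ds
  sum-digitCount []       = ≡.trans (≡.cong Vec.sum digitCount-[]) (sum-0ᵛ p)
  sum-digitCount (i ∷ ds) = ≡.trans (≡.cong Vec.sum (digitCount-∷ i ds))
                                    (≡.trans (sum-+ᵛ (unitᵛ i) (digitCount ds)) (≡.cong₂ _+_ (sum-unitᵛ i) (sum-digitCount ds)))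

  sum-expVec : ∀ n → Vec.sum (expVec n) ≡ length (digits n)
  sum-expVec n = sum-digitCount (digits n)

  expVec-step : ∀ q (i : Fin p) → 0 < p * q + toℕ i → expVec (p * q + toℕ i) ≡ unitᵛ i +ᵛ expVec q
  expVec-step q i 0<n = ≡.trans (≡.cong digitCount (digits-step q i 0<n)) (digitCount-∷ i (digits q))

  length-digits-p^ : ∀ N → length (digits (p ^ N)) ≡ suc N
  length-digits-p^ zero    = ≡.refl
  length-digits-p^ (suc N) = begin
    length (digits (p * p ^ N))          ≡⟨ ≡.cong (λ n → length (digits n)) p*p^N≡p*p^N+0 ⟩
    length (digits (p * p ^ N + toℕ 0ₚ)) ≡⟨ ≡.cong length (digits-step (p ^ N) 0ₚ 0<p*p^N+0) ⟩
    suc (length (digits (p ^ N)))        ≡⟨ ≡.cong suc (length-digits-p^ N) ⟩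
    suc (suc N)                          ∎
    where
    open ≡.≡-Reasoning
    0ₚ : Fin p
    0ₚ = fromℕ< (ℕₚ.≤-trans (s≤s z≤n) 2≤p)
    p*p^N≡p*p^N+0 : p * p ^ N ≡ p * p ^ N + toℕ 0ₚ
    p*p^N≡p*p^N+0 = ≡.sym (≡.trans (≡.cong (p * p ^ N +_) (Finₚ.toℕ-fromℕ< _)) (ℕₚ.+-identityʳ _))
    0<p*p^N+0 : 0 < p * p ^ N + toℕ 0ₚ
    0<p*p^N+0 = ≡.subst (0 <_) p*p^N≡p*p^N+0 (ℕₚ.m^n>0 p (suc N))

module GeneratingSeries {c ℓ} (R : CommutativeRing c ℓ) (p : ℕ) .{{_ : NonZero p}} (2≤p : 2 ≤ p) where
  open CommutativeRing R
  open Sums R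
  open Series R p
  open Gen R p using (L)
  open Auto R p using (Seq; shift; _≋_)
  open Digits p using (expVec; digits)
  open BaseDigits p 2≤p
  open ExponentVectors
  open import Relation.Binary.Reasoning.Setoid setoid

  term : Seq → Vec ℕ p → ℕ → Carrier
  term s m n = if does (Vecₚ.≡-dec ℕ._≟_ (expVec n) m) then s n else 0#

  L-∑< : ∀ s m → L s m ≡ ∑[ j < p ^ Vec.sum m ] term s m (suc j)
  L-∑< s m = ≡.trans (∑-map suc (upTo (p ^ Vec.sum m)) (term s m)) (∑-upTo (p ^ Vec.sum m) (λ j → term s m (suc j)))

  term-vanishes : ∀ s m n → length (digits n) ≢ Vec.sum m → term s m n ≡ 0#
  term-vanishes s m n ≢|m| = ≡.cong (λ b → if b then s n else 0#)
    (dec-false (Vecₚ.≡-dec ℕ._≟_ (expVec n) m) (λ expVec≡m → ≢|m| (≡.trans (≡.sym (sum-expVec n)) (≡.cong Vec.sum expVec≡m))))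

  L-cong : ∀ {s s′} → s ≋ s′ → L s ≐ L s′
  L-cong {s} {s′} s≋s′ m = begin
    L s m                                      ≡⟨ L-∑< s m ⟩
    ∑[ j < p ^ Vec.sum m ] term s m (suc j)    ≈⟨ ∑<-cong′ (p ^ Vec.sum m) sameTerm ⟩
    ∑[ j < p ^ Vec.sum m ] term s′ m (suc j)   ≡⟨ L-∑< s′ m ⟨
    L s′ m                                     ∎
    where
    sameTerm : ∀ j → term s m (suc j) ≈ term s′ m (suc j)
    sameTerm j with does (Vecₚ.≡-dec ℕ._≟_ (expVec (suc j)) m)
    ... | true  = s≋s′ (suc j) (s≤s z≤n)
    ... | false = refl

  digitPart shiftPart : Seq → Vec ℕ p → Carrier
  digitPart s m = ∑[ i ∈ allFin p ] (if does (toℕ i ℕ.≟ 0) then 0# else s (toℕ i) * var i m)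
  shiftPart s m = ∑[ i ∈ allFin p ] (if unitᵛ i ≤ᵛᵇ m then L (shift i s) (m ∸ᵛ unitᵛ i) else 0#)

  private
    0≢suc : ∀ {n} → 0 ≢ suc n
    0≢suc ()

    suc≢self : ∀ {n} → suc n ≢ n
    suc≢self {n} e = ℕₚ.<-irrefl (≡.sym e) (ℕₚ.n<1+n n)

    unitᵛ-≤ᵛᵇ⇒sum : ∀ (i : Fin p) (m : Vec ℕ p) → (unitᵛ i ≤ᵛᵇ m) ≡ true → Vec.sum m ≡ suc (Vec.sum (m ∸ᵛ unitᵛ i))
    unitᵛ-≤ᵛᵇ⇒sum i m eᵢ≤m = ≡.trans (≡.cong Vec.sum (≡.sym (+ᵛ-∸ᵛ (unitᵛ i) m eᵢ≤m)))
      (≡.trans (sum-+ᵛ (unitᵛ i) (m ∸ᵛ unitᵛ i)) (≡.cong (ℕ._+ Vec.sum (m ∸ᵛ unitᵛ i)) (sum-unitᵛ i)))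

  recurrence-constant : ∀ s m → Vec.sum m ≡ 0 → ∑[ j < p ^ 0 ] term s m (suc j) ≈ digitPart s m + shiftPart s m
  recurrence-constant s m |m|≡0 = begin
    term s m 1 + 0#             ≈⟨ +-identityʳ _ ⟩
    term s m 1                  ≡⟨ term-vanishes s m 1 (λ 1≡|m| → 0≢suc (≡.trans (≡.sym |m|≡0) (≡.sym 1≡|m|))) ⟩
    0#                          ≈⟨ +-identityʳ 0# ⟨
    0# + 0#                     ≈⟨ +-cong (trans (∑-cong (allFin p) noDigit) (∑-zero (allFin p))) (trans (∑-cong (allFin p) noShift) (∑-zero (allFin p))) ⟨
    digitPart s m + shiftPart s m ∎
    where
    noDigit : ∀ i → (if does (toℕ i ℕ.≟ 0) then 0# else s (toℕ i) * var i m) ≈ 0#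
    noDigit i with does (toℕ i ℕ.≟ 0)
    ... | true  = refl
    ... | false = trans (*-congˡ (reflexive (≡.cong (λ b → if b then 1# else 0#) (dec-false (Vecₚ.≡-dec ℕ._≟_ m (unitV i))
                    (λ m≡eᵢ → 0≢suc (≡.trans (≡.sym |m|≡0) (≡.trans (≡.cong Vec.sum m≡eᵢ) (sum-unitᵛ i)))))))) (zeroʳ _)
    noShift : ∀ i → (if unitᵛ i ≤ᵛᵇ m then L (shift i s) (m ∸ᵛ unitᵛ i) else 0#) ≈ 0#
    noShift i with unitᵛ i ≤ᵛᵇ m in eᵢ≤m
    ... | false = refl
    ... | true  = contradiction (≡.trans (≡.sym |m|≡0) (unitᵛ-≤ᵛᵇ⇒sum i m eᵢ≤m)) 0≢suc

  module _ (s : Seq) (m : Vec ℕ p) (N : ℕ) (|m|≡1+N : Vec.sum m ≡ suc N) where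
    private
      P = p ^ N
      instance
        P≢0 : NonZero P
        P≢0 = ℕₚ.m^n≢0 p N
      P′ = ℕ.pred P
      P≡1+P′ : P ≡ suc P′
      P≡1+P′ = ≡.sym (ℕₚ.suc-pred P)
      0<p : 0 < p
      0<p = ℕₚ.≤-trans (s≤s z≤n) 2≤p

    dropEnds : ∑[ j < p ℕ.* P ] term s m (suc j) ≈ ∑[ j < p ℕ.* P ] term s m j
    dropEnds = begin
      ∑[ j < p ℕ.* P ] term s m (suc j)                 ≈⟨ +-identityˡ _ ⟨
      0# + ∑[ j < p ℕ.* P ] term s m (suc j)            ≡⟨ ≡.cong (_+ ∑[ j < p ℕ.* P ] term s m (suc j)) (term-vanishes s m 0 (λ 0≡|m| → 0≢suc (≡.trans 0≡|m| |m|≡1+N))) ⟨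
      ∑< (suc (p ℕ.* P)) (term s m)                     ≈⟨ ∑<-snoc (p ℕ.* P) (term s m) ⟩
      ∑< (p ℕ.* P) (term s m) + term s m (p ℕ.* P)      ≡⟨ ≡.cong (∑< (p ℕ.* P) (term s m) +_) (term-vanishes s m (p ^ suc N) tooLong) ⟩
      ∑< (p ℕ.* P) (term s m) + 0#                      ≈⟨ +-identityʳ _ ⟩
      ∑< (p ℕ.* P) (term s m)                           ∎
      where
      tooLong : length (digits (p ^ suc N)) ≢ Vec.sum m
      tooLong len≡|m| = suc≢self (≡.trans (≡.sym (length-digits-p^ (suc N))) (≡.trans len≡|m| |m|≡1+N))

    leadingBlock : ∀ i → term s m (p ℕ.* 0 ℕ.+ toℕ i) ≈ (if does (toℕ i ℕ.≟ 0) then 0# else s (toℕ i) * var i m)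
    leadingBlock i with toℕ i in i≡
    ... | zero  = reflexive (term-vanishes s m _ (λ len≡|m| → 0≢suc (≡.trans (≡.trans (≡.cong (λ n → length (digits n)) (≡.sym p*0+0≡0)) len≡|m|) |m|≡1+N)))
      where
      p*0+0≡0 : p ℕ.* 0 ℕ.+ 0 ≡ 0
      p*0+0≡0 = ≡.cong (ℕ._+ 0) (ℕₚ.*-zeroʳ p)
    ... | suc r = begin
      term s m (p ℕ.* 0 ℕ.+ suc r)                             ≡⟨ ≡.cong₂ (λ b n → if b then s n else 0#) (≡.trans (≡.cong (λ v → does (Vecₚ.≡-dec ℕ._≟_ v m)) expVec≡eᵢ) (does-sym (unitᵛ i) m)) p*0+r≡r ⟩
      (if does (Vecₚ.≡-dec ℕ._≟_ m (unitᵛ i)) then s (suc r) else 0#) ≈⟨ if-*-indicator _ ⟩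
      s (suc r) * var i m                                      ∎
      where
      p*0+r≡r : p ℕ.* 0 ℕ.+ suc r ≡ suc r
      p*0+r≡r = ≡.cong (ℕ._+ suc r) (ℕₚ.*-zeroʳ p)
      expVec≡eᵢ : expVec (p ℕ.* 0 ℕ.+ suc r) ≡ unitᵛ i
      expVec≡eᵢ = ≡.trans (≡.cong (λ n → expVec (p ℕ.* 0 ℕ.+ n)) (≡.sym i≡))
                  (≡.trans (expVec-step 0 i (≡.subst (0 <_) (≡.cong (p ℕ.* 0 ℕ.+_) (≡.sym i≡)) (≡.subst (0 <_) (≡.sym p*0+r≡r) (s≤s z≤n))))
                  (≡.trans (≡.cong (unitᵛ i +ᵛ_) digitCount-[]) (+ᵛ-identityʳ (unitᵛ i))))
      does-sym : ∀ (u v : Vec ℕ p) → does (Vecₚ.≡-dec ℕ._≟_ u v) ≡ does (Vecₚ.≡-dec ℕ._≟_ v u)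
      does-sym u v = does-⇔ (mk⇔ ≡.sym ≡.sym) (Vecₚ.≡-dec ℕ._≟_ u v) (Vecₚ.≡-dec ℕ._≟_ v u)
      if-*-indicator : ∀ b → (if b then s (suc r) else 0#) ≈ s (suc r) * (if b then 1# else 0#)
      if-*-indicator true  = sym (*-identityʳ _)
      if-*-indicator false = sym (zeroʳ _)

    laterBlocks : ∀ i → ∑[ q < P′ ] term s m (p ℕ.* suc q ℕ.+ toℕ i) ≈ (if unitᵛ i ≤ᵛᵇ m then L (shift i s) (m ∸ᵛ unitᵛ i) else 0#)
    laterBlocks i = trans (∑<-cong′ P′ (λ q → reflexive (≡.cong (λ b → if b then shift i s (suc q) else 0#) (splitDigit q))))
                          (afterSplit (unitᵛ i ≤ᵛᵇ m) ≡.refl)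
      where
      m′ = m ∸ᵛ unitᵛ i
      0<n : ∀ q → 0 < p ℕ.* suc q ℕ.+ toℕ i
      0<n q = ℕₚ.<-≤-trans 0<p (ℕₚ.≤-trans (ℕₚ.m≤m*n p (suc q)) (ℕₚ.m≤m+n (p ℕ.* suc q) (toℕ i)))
      splitDigit : ∀ q → does (Vecₚ.≡-dec ℕ._≟_ (expVec (p ℕ.* suc q ℕ.+ toℕ i)) m)
                         ≡ ((unitᵛ i ≤ᵛᵇ m) ∧ does (Vecₚ.≡-dec ℕ._≟_ (expVec (suc q)) m′))
      splitDigit q = ≡.trans (≡.cong (λ v → does (Vecₚ.≡-dec ℕ._≟_ v m)) (expVec-step (suc q) i (0<n q)))
                             (does-+ᵛ≟ (unitᵛ i) (expVec (suc q)) m)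
      afterSplit : ∀ b → (unitᵛ i ≤ᵛᵇ m) ≡ b →
        ∑[ q < P′ ] (if b ∧ does (Vecₚ.≡-dec ℕ._≟_ (expVec (suc q)) m′) then shift i s (suc q) else 0#) ≈ (if b then L (shift i s) m′ else 0#)
      afterSplit false _      = ∑<-zero P′
      afterSplit true  eᵢ≤m = sym (begin
        L (shift i s) m′                                              ≡⟨ L-∑< (shift i s) m′ ⟩
        ∑[ j < p ^ Vec.sum m′ ] term (shift i s) m′ (suc j)            ≡⟨ ≡.cong (λ n → ∑[ j < n ] term (shift i s) m′ (suc j)) (≡.trans (≡.cong (p ^_) |m′|≡N) P≡1+P′) ⟩
        ∑[ j < suc P′ ] term (shift i s) m′ (suc j)                    ≈⟨ ∑<-snoc P′ _ ⟩
        ∑[ j < P′ ] term (shift i s) m′ (suc j) + term (shift i s) m′ (suc P′)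
                                                                       ≡⟨ ≡.cong (∑[ j < P′ ] term (shift i s) m′ (suc j) +_) (term-vanishes (shift i s) m′ (suc P′) tooLong) ⟩
        ∑[ j < P′ ] term (shift i s) m′ (suc j) + 0#                   ≈⟨ +-identityʳ _ ⟩
        ∑[ j < P′ ] term (shift i s) m′ (suc j)                        ∎)
        where
        |m′|≡N : Vec.sum m′ ≡ N
        |m′|≡N = ℕₚ.suc-injective (≡.trans (≡.sym (unitᵛ-≤ᵛᵇ⇒sum i m eᵢ≤m)) |m|≡1+N)
        tooLong : length (digits (suc P′)) ≢ Vec.sum m′
        tooLong len≡|m′| = suc≢self (≡.trans (≡.sym (length-digits-p^ N)) (≡.trans (≡.cong (λ n → length (digits n)) P≡1+P′) (≡.trans len≡|m′| |m′|≡N)))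

    recurrence-suc : ∑[ j < p ^ suc N ] term s m (suc j) ≈ digitPart s m + shiftPart s m
    recurrence-suc = begin
      ∑[ j < p ℕ.* P ] term s m (suc j)                                  ≈⟨ dropEnds ⟩
      ∑[ j < p ℕ.* P ] term s m j                                        ≈⟨ ∑<-blocks p P (term s m) ⟩
      ∑[ q < P ] ∑[ r < p ] term s m (p ℕ.* q ℕ.+ r)                     ≈⟨ ∑<-cong′ P (λ q → reflexive (∑<-allFin p (λ r → term s m (p ℕ.* q ℕ.+ r)))) ⟩
      ∑[ q < P ] ∑[ i ∈ allFin p ] term s m (p ℕ.* q ℕ.+ toℕ i)          ≡⟨ ≡.cong (λ n → ∑[ q < n ] ∑[ i ∈ allFin p ] term s m (p ℕ.* q ℕ.+ toℕ i)) P≡1+P′ ⟩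
      ∑[ i ∈ allFin p ] term s m (p ℕ.* 0 ℕ.+ toℕ i) + ∑[ q < P′ ] ∑[ i ∈ allFin p ] term s m (p ℕ.* suc q ℕ.+ toℕ i)
                                                                         ≈⟨ +-congˡ (∑-∑< (allFin p) P′ (λ i q → term s m (p ℕ.* suc q ℕ.+ toℕ i))) ⟨
      ∑[ i ∈ allFin p ] term s m (p ℕ.* 0 ℕ.+ toℕ i) + ∑[ i ∈ allFin p ] ∑[ q < P′ ] term s m (p ℕ.* suc q ℕ.+ toℕ i)
                                                                         ≈⟨ +-cong (∑-cong (allFin p) leadingBlock) (∑-cong (allFin p) laterBlocks) ⟩
      digitPart s m + shiftPart s m                                      ∎

  L-recurrence : ∀ s → L s ≐ (linForm (λ i → s (toℕ i)) ⊕ sumS (map (λ i → var i ⊗ L (shift i s)) (allFin p)))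
  L-recurrence s m = begin
    L s m                                             ≡⟨ L-∑< s m ⟩
    ∑[ j < p ^ Vec.sum m ] term s m (suc j)           ≈⟨ byDegree ⟩
    digitPart s m + shiftPart s m                     ≈⟨ +-cong (reflexive digitPart≡linForm) (∑-cong (allFin p) shiftTerm) ⟨
    linForm (λ i → s (toℕ i)) m + ∑[ i ∈ allFin p ] (var i ⊗ L (shift i s)) m
                                                      ≡⟨ ≡.cong (linForm (λ i → s (toℕ i)) m +_) shiftSum ⟨
    (linForm (λ i → s (toℕ i)) ⊕ sumS (map (λ i → var i ⊗ L (shift i s)) (allFin p))) m ∎
    where
    open PowerSeries R p using (sumS-apply)
    open Convolution R p using (∑split-δ)
    byDegree : ∑[ j < p ^ Vec.sum m ] term s m (suc j) ≈ digitPart s m + shiftPart s m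
    byDegree with Vec.sum m in |m|≡
    ... | zero  = recurrence-constant s m |m|≡
    ... | suc N = recurrence-suc s m N |m|≡
    digitPart≡linForm : linForm (λ i → s (toℕ i)) m ≡ digitPart s m
    digitPart≡linForm = ≡.trans (sumS-apply (map digit (allFin p)) m) (∑-map digit (allFin p) (λ f → f m))
      where
      digit : Fin p → PS
      digit i m = if does (toℕ i ℕ.≟ 0) then 0# else s (toℕ i) * var i m
    shiftSum : sumS (map (λ i → var i ⊗ L (shift i s)) (allFin p)) m ≡ ∑[ i ∈ allFin p ] (var i ⊗ L (shift i s)) m
    shiftSum = ≡.trans (sumS-apply (map (λ i → var i ⊗ L (shift i s)) (allFin p)) m) (∑-map (λ i → var i ⊗ L (shift i s)) (allFin p) (λ f → f m))
    shiftTerm : ∀ i → (var i ⊗ L (shift i s)) m ≈ (if unitᵛ i ≤ᵛᵇ m then L (shift i s) (m ∸ᵛ unitᵛ i) else 0#)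
    shiftTerm i = ∑split-δ m (unitᵛ i) (λ _ b → L (shift i s) b)

module PolynomialQuasiAdjugate {c ℓ} (S : CommutativeRing c ℓ) (p : ℕ) where
  open Series S p using (IsPoly)
  open PowerSeries S p
  open SquareMatrices ⊕-⊗-commutativeRing
  open QuasiAdjugate ⊕-⊗-commutativeRing

  private
    variable
      n : ℕ

    IsPoly-schurComplement : (M : Matrix (suc n)) → (∀ u v → IsPoly (M u v)) → ∀ u v → IsPoly (schurComplement M u v)
    IsPoly-schurComplement M M-poly u v = IsPoly-⊕ (IsPoly-⊗ (M-poly _ _) (M-poly _ _)) (IsPoly-⊖ (IsPoly-⊗ (M-poly _ _) (M-poly _ _)))

  IsPoly-quasiDet : (M : Matrix n) → (∀ u v → IsPoly (M u v)) → IsPoly (quasiDet M)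
  IsPoly-quasiDet {zero}  M M-poly = IsPoly-oneS
  IsPoly-quasiDet {suc n} M M-poly = IsPoly-⊗ (M-poly _ _) (IsPoly-quasiDet (schurComplement M) (IsPoly-schurComplement M M-poly))

  IsPoly-quasiAdj : (M : Matrix n) → (∀ u v → IsPoly (M u v)) → ∀ u v → IsPoly (quasiAdj M u v)
  IsPoly-quasiAdj {suc n} M M-poly = IsPoly-bordered
    where
    open Bordering M (quasiDet (schurComplement M)) (quasiAdj (schurComplement M))
    M′-poly = IsPoly-schurComplement M M-poly
    B′-poly = IsPoly-quasiAdj (schurComplement M) M′-poly
    ws = allFin n
    rowB′-poly : ∀ w → IsPoly (rowB′ w)
    rowB′-poly w = IsPoly-sumS _ ws (λ u → IsPoly-⊗ (M-poly _ _) (B′-poly u w))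
    B′col-poly : ∀ u → IsPoly (B′col u)
    B′col-poly u = IsPoly-sumS _ ws (λ w → IsPoly-⊗ (B′-poly u w) (M-poly _ _))
    IsPoly-bordered : ∀ u v → IsPoly (bordered u v)
    IsPoly-bordered Fin.zero    Fin.zero    = IsPoly-⊕ (IsPoly-quasiDet _ M′-poly) (IsPoly-sumS _ ws (λ u → IsPoly-⊗ (M-poly _ _) (B′col-poly u)))
    IsPoly-bordered Fin.zero    (Fin.suc w) = IsPoly-⊖ (IsPoly-⊗ (M-poly _ _) (rowB′-poly w))
    IsPoly-bordered (Fin.suc u) Fin.zero    = IsPoly-⊖ (IsPoly-⊗ (M-poly _ _) (B′col-poly u))
    IsPoly-bordered (Fin.suc u) (Fin.suc w) = IsPoly-⊗ (IsPoly-⊗ (M-poly _ _) (M-poly _ _)) (B′-poly u w)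

module TransferMatrix {c ℓ} (S : CommutativeRing c ℓ) (p : ℕ) {k : ℕ} (t : Fin k → Fin p → Fin k) where
  private
    module S = CommutativeRing S
    module MS = SquareMatrices S
  open Series S p using (PS; IsPoly; NonZeroS; IminusM; var; zeroS; idM; adjM)
  open PowerSeries S p
  open SquareMatrices ⊕-⊗-commutativeRing
  open QuasiAdjugate ⊕-⊗-commutativeRing
  open ExponentVectors

  A : Matrix k
  A = IminusM t

  constant-A : ∀ u v → constant (A u v) S.≈ MS.scalar S.1# u v
  constant-A u v = S.trans (S.+-cong constant-idM (S.-‿cong constant-adjM)) (S.trans (S.+-congˡ ε⁻¹≈ε) (S.+-identityʳ _))
    where
    open import Algebra.Properties.Group S.+-group using (ε⁻¹≈ε)
    open Sums S using (∑-map; ∑-cong; ∑-zero)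
    constant-idM : constant (idM u v) S.≈ MS.scalar S.1# u v
    constant-idM with does (u Fin.≟ v)
    ... | true  = constant-oneS
    ... | false = S.refl
    arrow : Fin p → PS
    arrow i = if does (t u i Fin.≟ v) then var i else zeroS
    constant-arrow : ∀ i → constant (arrow i) S.≈ S.0#
    constant-arrow i with does (t u i Fin.≟ v)
    ... | true  = constant-var i
    ... | false = S.refl
    constant-adjM : constant (adjM t u v) S.≈ S.0#
    constant-adjM = S.trans (S.reflexive (≡.trans (sumS-apply (map arrow (allFin p)) 0ᵛ) (∑-map arrow (allFin p) (λ f → f 0ᵛ))))
                            (S.trans (∑-cong (allFin p) constant-arrow) (∑-zero (allFin p)))

  constant-quasiDet : constant (quasiDet A) S.≈ S.1#
  constant-quasiDet = quasiDet-homo-1# S constant-isRingHomomorphism A constant-A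

  IsPoly-A : ∀ u v → IsPoly (A u v)
  IsPoly-A u v = IsPoly-⊕ IsPoly-idM (IsPoly-⊖ (IsPoly-sumS _ (allFin p) IsPoly-arrow))
    where
    IsPoly-idM : IsPoly (idM u v)
    IsPoly-idM with does (u Fin.≟ v)
    ... | true  = IsPoly-oneS
    ... | false = IsPoly-zeroS
    IsPoly-arrow : ∀ i → IsPoly (if does (t u i Fin.≟ v) then var i else zeroS)
    IsPoly-arrow i with does (t u i Fin.≟ v)
    ... | true  = IsPoly-var i
    ... | false = IsPoly-zeroS

  quasiDet-nonZero : ¬ (S.1# S.≈ S.0#) → NonZeroS (quasiDet A)
  quasiDet-nonZero 1≉0 = 0ᵛ , λ d₀≈0 → 1≉0 (S.trans (S.sym constant-quasiDet) d₀≈0)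

  private
    module T = CommutativeRing ⊕-⊗-commutativeRing
    module D = UnitInverse S p (quasiDet A) constant-quasiDet

  A⁻¹ : Matrix k
  A⁻¹ = scale D.d⁻¹ (quasiAdj A)

  A⁻¹·A : A⁻¹ · A ≋ scalar T.1#
  A⁻¹·A u v = T.trans (scale-· D.d⁻¹ (quasiAdj A) A u v) (scale-scalar (quasiAdj-· A) (T.trans (T.*-comm D.d⁻¹ _) D.d*d⁻¹≈1) u v)

  A·A⁻¹ : A · A⁻¹ ≋ scalar T.1#
  A·A⁻¹ u v = T.trans (·-scale D.d⁻¹ A (quasiAdj A) u v) (scale-scalar (·-quasiAdj A) (T.trans (T.*-comm D.d⁻¹ _) D.d*d⁻¹≈1) u v)

  adjM▹ : (x : Fin k → PS) → ∀ u → (adjM t ▹ x) u T.≈ Series.sumS S p (map (λ i → Series._⊗_ S p (var i) (x (t u i))) (allFin p))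
  adjM▹ x u = ∑-scalar-▹ (allFin p) var (t u) x

IminusM-invertibleOverQx : ∀ p {k} (t : Fin k → Fin p → Fin k) → InvertibleOverQx p (ZSeries.IminusM p t)
IminusM-invertibleOverQx p t =
  quasiAdj A , quasiDet A , IsPoly-quasiAdj A IsPoly-A , IsPoly-quasiDet A IsPoly-A , quasiDet-nonZero (λ ()) , ·-quasiAdj A , quasiAdj-· A
  where
  open TransferMatrix +-*-commutativeRing p t
  open QuasiAdjugate (PowerSeries.⊕-⊗-commutativeRing +-*-commutativeRing p)
  open PolynomialQuasiAdjugate +-*-commutativeRing p

module KernelSystem {c ℓ} (R : CommutativeRing c ℓ) (p : ℕ) .{{_ : NonZero p}} (2≤p : 2 ≤ p)
                    {k : ℕ} (e : Fin k → Auto.Seq R p) (t : Fin k → Fin p → Fin k)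
                    (e∘t≋shift : ∀ u i → Auto._≋_ R p (e (t u i)) (Auto.shift R p i (e u))) where
  open Series R p using (PS; linForm; var; adjM; sumS; _⊗_; _≐_)
  open PowerSeries R p using (⊕-⊗-commutativeRing)
  open CommutativeRing ⊕-⊗-commutativeRing
  open SquareMatrices ⊕-⊗-commutativeRing
  open TransferMatrix R p t
  open GeneratingSeries R p 2≤p
  open Gen R p using (L)
  open Auto R p using (shift)
  open import Algebra.Properties.Group +-group using (//-rightDividesʳ)
  open import Relation.Binary.Reasoning.Setoid setoid

  Λ C : Fin k → PS
  Λ u = L (e u)
  C u = linForm (λ i → e u (toℕ i))

  A▹Λ≈C : ∀ u → (A ▹ Λ) u ≐ C u
  A▹Λ≈C u = begin
    (A ▹ Λ) u                 ≈⟨ [1-M]▹ (adjM t) Λ u ⟩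
    Λ u - (adjM t ▹ Λ) u      ≈⟨ +-cong (L-recurrence (e u)) (-‿cong (adjM▹ Λ u)) ⟩
    C u + X′ - X              ≈⟨ +-congʳ (+-congˡ (Sums.∑-cong ⊕-⊗-commutativeRing (allFin p) (λ i → *-congˡ (sym (L-cong (e∘t≋shift u i)))))) ⟩
    C u + X - X               ≈⟨ //-rightDividesʳ X (C u) ⟩
    C u                       ∎
    where
    X X′ : PS
    X  = sumS (map (λ i → var i ⊗ Λ (t u i)) (allFin p))
    X′ = sumS (map (λ i → var i ⊗ L (shift i (e u))) (allFin p))

  A⁻¹▹C≈Λ : ∀ u → (A⁻¹ ▹ C) u ≐ Λ u
  A⁻¹▹C≈Λ = left-inverse-solves A⁻¹·A A▹Λ≈C

mainTheorem8 :
    ∀ {c ℓ : Level} (R : CommutativeRing c ℓ) (p : ℕ) {{_ : NonZero p}} → 2 ≤ p →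
    (a : ℕ → CommutativeRing.Carrier R) → Auto.IsAutomatic R p a →
    (k : ℕ) (e : Fin k → Auto.Seq R p) → Auto.EnumeratesKernel R p a k e →
    (t : Fin k → Fin p → Fin k) →
    (∀ u i → Auto._≋_ R p (e (t u i)) (Auto.shift R p i (e u))) →
    (u₀ : Fin k) → Auto._≋_ R p (e u₀) a →
    InvertibleOverQx p (ZSeries.IminusM p t)
    × Σ (Fin k → Fin p → CommutativeRing.Carrier R) λ cf →
        Σ (Series.Mat R p k) λ Inv →
          Series._≐M_ R p (Series._·_ R p Inv (Series.IminusM R p t)) (Series.idM R p)
          × Series._≐M_ R p (Series._·_ R p (Series.IminusM R p t) Inv) (Series.idM R p)
          × Series._≐_ R p (Series._▹_ R p Inv (λ u → Series.linForm R p (cf u)) u₀) (Gen.L R p a)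
mainTheorem8 R p 2≤p a _ k e _ t e∘t≋shift u₀ e-u₀≋a =
  IminusM-invertibleOverQx p t ,
  (λ u i → e u (toℕ i)) , A⁻¹ , A⁻¹·A , A·A⁻¹ ,
  λ m → CommutativeRing.trans R (A⁻¹▹C≈Λ u₀ m) (L-cong e-u₀≋a m)
  where
  open KernelSystem R p 2≤p e t e∘t≋shift
  open TransferMatrix R p t using (A⁻¹; A⁻¹·A; A·A⁻¹)
  open GeneratingSeries R p 2≤p using (L-cong)
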